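{- Let $n\ge 4$. Among all spiro hexagonal chains with $n$ hexagons: (i) the unique one with maximum Wiener index is the spiro para-chain $P_n$; (ii) the unique one with the second maximal Wiener index is the chain with cut-vertex sequence $(c_2,\dots,c_{n-1})=(p_1,\dots,p_{n-3},m_{n-2})$; (iii) the unique one with the third maximal Wiener index is the chain with cut-vertex sequence $(c_2,\dots,c_{n-1})=(p_1,\dots,p_{n-4},m_{n-3},p_{n-2})$.
   Context: The Wiener index is $W(G)=\sum_{\{u,v\}\subseteq V(G)} d(u,v)$, with $d$ the shortest-path distance. A spiro hexagonal chain with $n$ hexagons is a graph $G_n=H_0H_1\cdots H_{n-1}$ that is the union of hexagons (6-cycles) $H_0,\dots,H_{n-1}$ such that for $1\le k\le n-1$, $H_{k-1}$ and $H_k$ share exactly one vertex $c_k$, the $c_k$ are distinct, and $H_i,H_j$ are disjoint when $|i-j|\ge 2$. For $k\ge 1$, a vertex of $H_k$ at distance $1$, $2$, $3$ from $c_k$ is denoted $o_k$, $m_k$, $p_k$ (ortho-, meta-, para-vertex). The cut-vertex sequence $(c_2,\dots,c_{n-1})$ records, for each $k$, whether $c_k$ is $o_{k-1}$, $m_{k-1}$ or $p_{k-1}$; it determines the chain up to isomorphism, and a sequence and its reversal (in terms of types) determine the same chain. The spiro para-chain $P_n$ is the chain with $c_k=p_{k-1}$ for all $2\le k\le n-1$. Chains are considered up to isomorphism. -}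

module Defs where

open import Data.Nat using (ℕ; zero; suc; _+_; _*_; _∸_; _<ᵇ_; _≡ᵇ_)
open import Data.Nat.DivMod using (_%_)
open import Data.Bool using (Bool; true; false; _∨_; _∧_; if_then_else_)
open import Data.List using (List; []; _∷_; length; upTo; map; concatMap)
open import Data.Bool.ListAction using (any)
open import Data.Nat.ListAction using (sum)
open import Data.Fin using (Fin; toℕ)
open import Data.Product using (Σ)
open import Function.Bundles using (_↔_; Inverse)
open import Relation.Binary.PropositionalEquality using (_≡_)

-- Finite simple graphs on the vertex set {0, …, N-1} (vertices as ℕ),
-- given by a Boolean adjacency function.

record Graph : Set where
  field
    N   : ℕ
    adj : ℕ → ℕ → Bool
open Graph public

verts : Graph → List ℕ
verts G = upTo (N G)

inBall : Graph → ℕ → ℕ → ℕ → Bool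
inBall G u zero    v = u ≡ᵇ v
inBall G u (suc k) v =
  inBall G u k v ∨ any (λ w → inBall G u k w ∧ adj G w v) (verts G)

-- least i with  i < bound  and  p i = true  (bound if there is none)
firstTrue : ℕ → (ℕ → Bool) → ℕ
firstTrue zero      p = zero
firstTrue (suc b)   p = if p zero then zero else suc (firstTrue b (λ i → p (suc i)))

-- shortest-path distance d(u,v): the least k such that there is a walk of
-- length ≤ k from u to v (a shortest walk has length < N; for the connected
-- graphs considered here this is always found)
dist : Graph → ℕ → ℕ → ℕ
dist G u v = firstTrue (N G) (λ k → inBall G u k v)

wiener : Graph → ℕ
wiener G = sum (concatMap (λ v → map (λ u → dist G u v) (upTo v)) (verts G))

_≅_ : Graph → Graph → Set
G ≅ H = Σ (Fin (N G) ↔ Fin (N H)) λ f →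
  ∀ (x y : Fin (N G)) →
    adj G (toℕ x) (toℕ y) ≡ adj H (toℕ (Inverse.to f x)) (toℕ (Inverse.to f y))

-- type of a cut vertex c_k relative to c_{k-1} in H_{k-1}
data Pos : Set where
  ortho meta para : Pos

-- position (distance along the hexagon from c_{k-1}) of the type
posNum : Pos → ℕ
posNum ortho = 1
posNum meta  = 2
posNum para  = 3

-- Hexagon H_k has local positions j = 0..5 around the cycle, position 0 of
-- H_k (k ≥ 1) being c_k.  For H_0 we put c_1 at position 0 (any choice is
-- equivalent by symmetry).  A cut-vertex sequence s = (type of c_2, …,
-- type of c_{n-1}) gives a chain with n = length s + 2 hexagons.

-- local position in H_k of c_{k+1}
nextCut : List Pos → ℕ → ℕ
nextCut s zero    = 0
nextCut s (suc k) = go s k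
  where
  go : List Pos → ℕ → ℕ
  go []       _       = 0
  go (x ∷ xs) zero    = posNum x
  go (x ∷ xs) (suc i) = go xs i

-- global vertex number of the vertex at local position j (< 6) of H_k.
-- H_0 : 0..5 ; H_{k+1} : position 0 is c_{k+1}, positions 1..5 are new
-- vertices 6+5k, …, 10+5k.
vid : List Pos → ℕ → ℕ → ℕ
vid s zero    j       = j
vid s (suc k) zero    = vid s k (nextCut s k)
vid s (suc k) (suc j) = 6 + 5 * k + j

hexCount : List Pos → ℕ
hexCount s = length s + 2

chain : List Pos → Graph
chain s = record
  { N   = 5 * hexCount s + 1
  ; adj = λ x y → any (λ k → any (λ j → edgeAt k j x y) (upTo 6)) (upTo (hexCount s))
  }
  where
  edgeAt : ℕ → ℕ → ℕ → ℕ → Bool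
  edgeAt k j x y =
    ((vid s k j ≡ᵇ x) ∧ (vid s k ((suc j) % 6) ≡ᵇ y)) ∨
    ((vid s k j ≡ᵇ y) ∧ (vid s k ((suc j) % 6) ≡ᵇ x))

module Submission where

-- A chain is given by its cut-vertex sequence s of length L = n - 2.
--  1. Graph facts valid for every graph of Defs: a vertex labelling that vanishes only
--     at u, is 1-Lipschitz along edges and strictly decreases along some edge from every
--     other vertex is the distance from u (IsDistanceFrom); isomorphic graphs with
--     symmetric distances have equal Wiener indices.
--  2. An explicit distance formula in a chain (chainDist): a shortest path from u to a
--     vertex of H_k runs through the cut vertices between their hexagons, and inside each
--     hexagon along the 6-cycle.
--     A chain is isomorphic to the chain of the reversed sequence, so the extremal
--     sequences are unique up to isomorphism; chains with different Δ are not isomorphic.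

open import Defs
open import Data.Nat
open import Data.Nat.Properties
open import Data.Nat.DivMod using (_%_; m%n<n)
open import Data.Nat.ListAction using (sum)
open import Data.Nat.ListAction.Properties using (sum-++)
open import Data.Nat.Tactic.RingSolver using (solve-∀)
open import Data.Bool using (Bool; true; false; _∨_; _∧_; if_then_else_; T)
open import Data.Bool.ListAction using (any)
open import Data.Unit using (tt)
open import Data.List using (List; []; _∷_; _++_; replicate; length; reverse; map; concatMap; concat; applyUpTo; upTo)
open import Data.List.Properties using (length-++; length-replicate; length-reverse; unfold-reverse; reverse-++; ++-assoc; reverse-involutive)
open import Data.Fin using (Fin; toℕ; fromℕ<)
open import Data.Fin.Properties using (toℕ-fromℕ<; toℕ<n; toℕ-injective; cantor-schröder-bernstein)
open import Data.Product using (Σ; _×_; _,_; proj₁; proj₂)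
open import Data.Sum using (_⊎_; inj₁; inj₂)
open import Data.Empty using (⊥-elim)
open import Function using (_∘_; id)
open import Function.Bundles using (Inverse; mk↔ₛ′)
open import Relation.Binary using (tri<; tri≈; tri>)
open import Relation.Binary.PropositionalEquality
open import Relation.Nullary using (¬_; Dec; yes; no)
import Algebra.Properties.CommutativeMonoid.Sum as CommutativeMonoidSum
open CommutativeMonoidSum +-0-commutativeMonoid using (sum-permute; sum-cong-≗) renaming (sum to ∑ᶠ)

∑ : ℕ → (ℕ → ℕ) → ℕ
∑ zero    f = 0
∑ (suc n) f = f 0 + ∑ n (f ∘ suc)

∑-cong : ∀ n {f g} → (∀ i → i < n → f i ≡ g i) → ∑ n f ≡ ∑ n g
∑-cong zero    f≡g = refl
∑-cong (suc n) f≡g = cong₂ _+_ (f≡g 0 z<s) (∑-cong n (λ i i<n → f≡g (suc i) (s<s i<n)))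

∑-last : ∀ n f → ∑ (suc n) f ≡ ∑ n f + f n
∑-last zero    f = +-comm (f 0) 0
∑-last (suc n) f = trans (cong (f 0 +_) (∑-last n (f ∘ suc))) (sym (+-assoc (f 0) _ _))

∑-+ : ∀ n f g → ∑ n (λ i → f i + g i) ≡ ∑ n f + ∑ n g
∑-+ zero    f g = refl
∑-+ (suc n) f g rewrite ∑-+ n (f ∘ suc) (g ∘ suc) = shuffle (f 0) (g 0) (∑ n (f ∘ suc)) (∑ n (g ∘ suc))
  where
  shuffle : ∀ a b c d → a + b + (c + d) ≡ a + c + (b + d)
  shuffle = solve-∀

∑-const : ∀ n c → ∑ n (λ _ → c) ≡ n * c
∑-const zero    c = refl
∑-const (suc n) c = cong (c +_) (∑-const n c)

∑-split : ∀ m n f → ∑ (m + n) f ≡ ∑ m f + ∑ n (λ i → f (m + i))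
∑-split zero    n f = refl
∑-split (suc m) n f = trans (cong (f 0 +_) (∑-split m n (f ∘ suc))) (sym (+-assoc (f 0) _ _))

sum-applyUpTo : ∀ (f : ℕ → ℕ) g n → sum (map f (applyUpTo g n)) ≡ ∑ n (f ∘ g)
sum-applyUpTo f g zero    = refl
sum-applyUpTo f g (suc n) = cong (f (g 0) +_) (sum-applyUpTo f (g ∘ suc) n)

sum-concatMap : ∀ {A : Set} (g : A → List ℕ) xs → sum (concatMap g xs) ≡ sum (map (sum ∘ g) xs)
sum-concatMap g []       = refl
sum-concatMap g (x ∷ xs) =
  trans (sum-++ (g x) (concat (map g xs))) (cong (sum (g x) +_) (sum-concatMap g xs))

∑-∑ᶠ : ∀ n h → ∑ n h ≡ ∑ᶠ {n} (λ i → h (toℕ i))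
∑-∑ᶠ zero    h = refl
∑-∑ᶠ (suc n) h = cong (h 0 +_) (∑-∑ᶠ n (h ∘ suc))

∑²-symmetric : ∀ n (g : ℕ → ℕ → ℕ) → (∀ u v → u < n → v < n → g u v ≡ g v u) → (∀ v → v < n → g v v ≡ 0) →
               ∑ n (λ v → ∑ n (λ u → g u v)) ≡ ∑ n (λ v → ∑ v (λ u → g u v)) + ∑ n (λ v → ∑ v (λ u → g u v))
∑²-symmetric zero    g sym-g diag-g = refl
∑²-symmetric (suc n) g sym-g diag-g = begin
    ∑ (suc n) (λ v → ∑ (suc n) (λ u → g u v))
  ≡⟨ ∑-cong (suc n) (λ v _ → ∑-last n (λ u → g u v)) ⟩
    ∑ (suc n) (λ v → ∑ n (λ u → g u v) + g n v)
  ≡⟨ ∑-last n (λ v → ∑ n (λ u → g u v) + g n v) ⟩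
    ∑ n (λ v → ∑ n (λ u → g u v) + g n v) + (column + g n n)
  ≡⟨ cong₂ _+_ (∑-+ n (λ v → ∑ n (λ u → g u v)) (g n)) (cong (column +_) (diag-g n ≤-refl)) ⟩
    (∑ n (λ v → ∑ n (λ u → g u v)) + ∑ n (g n)) + (column + 0)
  ≡⟨ cong₂ (λ a b → (a + b) + (column + 0)) (∑²-symmetric n g (λ u v u< v< → sym-g u v (m<n⇒m<1+n u<) (m<n⇒m<1+n v<))
                                                                (λ v v< → diag-g v (m<n⇒m<1+n v<)))
                                            (∑-cong n (λ v v< → sym-g n v ≤-refl (m<n⇒m<1+n v<))) ⟩
    (half n + half n + column) + (column + 0)
  ≡⟨ regroup (half n) column ⟩
    (half n + column) + (half n + column)
  ≡⟨ cong₂ _+_ (sym (∑-last n (λ v → ∑ v (λ u → g u v)))) (sym (∑-last n (λ v → ∑ v (λ u → g u v)))) ⟩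
    half (suc n) + half (suc n)
  ∎
  where
  open ≡-Reasoning
  half : ℕ → ℕ
  half m = ∑ m (λ v → ∑ v (λ u → g u v))
  column : ℕ
  column = ∑ n (λ u → g u n)
  regroup : ∀ h x → h + h + x + (x + 0) ≡ h + x + (h + x)
  regroup = solve-∀

true⇒T : ∀ {b} → b ≡ true → T b
true⇒T refl = tt

∧-trueˡ : ∀ a b → (a ∧ b) ≡ true → a ≡ true
∧-trueˡ true b _ = refl

∧-trueʳ : ∀ a b → (a ∧ b) ≡ true → b ≡ true
∧-trueʳ true b e = e

∨-true : ∀ a b → (a ∨ b) ≡ true → (a ≡ true) ⊎ (b ≡ true)
∨-true true  b _ = inj₁ refl
∨-true false b e = inj₂ e

∨-trueˡ : ∀ a b → a ≡ true → (a ∨ b) ≡ true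
∨-trueˡ true b _ = refl

∨-trueʳ : ∀ a b → b ≡ true → (a ∨ b) ≡ true
∨-trueʳ true  b _ = refl
∨-trueʳ false b e = e

bool-ext : ∀ {b c : Bool} → (b ≡ true → c ≡ true) → (c ≡ true → b ≡ true) → b ≡ c
bool-ext {true}  {true}  f g = refl
bool-ext {true}  {false} f g = sym (f refl)
bool-ext {false} {true}  f g = g refl
bool-ext {false} {false} f g = refl

≡ᵇ-sound : ∀ {m n} → (m ≡ᵇ n) ≡ true → m ≡ n
≡ᵇ-sound {m} {n} e = ≡ᵇ⇒≡ m n (true⇒T e)

≡ᵇ-refl : ∀ n → (n ≡ᵇ n) ≡ true
≡ᵇ-refl zero    = refl
≡ᵇ-refl (suc n) = ≡ᵇ-refl n

≤ᵇ-sound : ∀ {m n} → (m ≤ᵇ n) ≡ true → m ≤ n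
≤ᵇ-sound {m} {n} e = ≤ᵇ⇒≤ m n (true⇒T e)

≤ᵇ-complete : ∀ m {n} → m ≤ n → (m ≤ᵇ n) ≡ true
≤ᵇ-complete m {n} m≤n with m ≤ᵇ n | ≤⇒≤ᵇ m≤n
... | true | _ = refl

≤ᵇ-false : ∀ m {n} → n < m → (m ≤ᵇ n) ≡ false
≤ᵇ-false m {n} n<m with m ≤ᵇ n in eq
... | false = refl
... | true  = ⊥-elim (<⇒≱ n<m (≤ᵇ-sound eq))

any-intro : ∀ (p : ℕ → Bool) g n i → i < n → p (g i) ≡ true → any p (applyUpTo g n) ≡ true
any-intro p g (suc n) zero    _         e = ∨-trueˡ (p (g 0)) _ e
any-intro p g (suc n) (suc i) (s≤s i<n) e = ∨-trueʳ (p (g 0)) _ (any-intro p (g ∘ suc) n i i<n e)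

any-elim : ∀ (p : ℕ → Bool) g n → any p (applyUpTo g n) ≡ true → Σ ℕ λ i → i < n × p (g i) ≡ true
any-elim p g (suc n) e with p (g 0) in eq
... | true  = 0 , z<s , eq
... | false with any-elim p (g ∘ suc) n e
...   | i , i<n , e′ = suc i , s<s i<n , e′

-- Graph distances that are given by a labelling

firstTrue-least : ∀ b (p : ℕ → Bool) c → c < b → (∀ k → k < c → p k ≡ false) → p c ≡ true → firstTrue b p ≡ c
firstTrue-least (suc b) p zero    _         _       pc rewrite pc = refl
firstTrue-least (suc b) p (suc c) (s≤s c<b) earlier pc rewrite earlier 0 z<s =
  cong suc (firstTrue-least b (p ∘ suc) c c<b (λ k k<c → earlier (suc k) (s<s k<c)) pc)

record IsDistanceFrom (G : Graph) (u : ℕ) (d : ℕ → ℕ) : Set where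
  field
    at-source   : d u ≡ 0
    only-source : ∀ v → d v ≡ 0 → u ≡ v
    lipschitz   : ∀ w v → adj G w v ≡ true → d v ≤ suc (d w)
    descent     : ∀ v m → v < N G → d v ≡ suc m →
                  Σ ℕ λ w → w < N G × adj G w v ≡ true × d w ≡ m

module _ {G : Graph} {u : ℕ} {d : ℕ → ℕ} (isDist : IsDistanceFrom G u d) where
  open IsDistanceFrom isDist

  inBall-labelling : ∀ k v → v < N G → inBall G u k v ≡ (d v ≤ᵇ k)
  inBall-labelling zero v v< = bool-ext to-label from-label
    where
    to-label : (u ≡ᵇ v) ≡ true → (d v ≤ᵇ 0) ≡ true
    to-label e with ≡ᵇ-sound {u} {v} e
    ... | refl rewrite at-source = refl
    from-label : (d v ≤ᵇ 0) ≡ true → (u ≡ᵇ v) ≡ true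
    from-label e with only-source v (n≤0⇒n≡0 (≤ᵇ-sound e))
    ... | refl = ≡ᵇ-refl u
  inBall-labelling (suc k) v v< = bool-ext to-label from-label
    where
    grows : ℕ → Bool
    grows w = inBall G u k w ∧ adj G w v
    to-label : (inBall G u k v ∨ any grows (verts G)) ≡ true → (d v ≤ᵇ suc k) ≡ true
    to-label e with ∨-true (inBall G u k v) _ e
    ... | inj₁ old = ≤ᵇ-complete (d v) (m≤n⇒m≤1+n (≤ᵇ-sound (trans (sym (inBall-labelling k v v<)) old)))
    ... | inj₂ new with any-elim grows (λ z → z) (N G) new
    ...   | w , w< , gw = ≤ᵇ-complete (d v) (≤-trans (lipschitz w v (∧-trueʳ (inBall G u k w) _ gw))
                            (s≤s (≤ᵇ-sound (trans (sym (inBall-labelling k w w<)) (∧-trueˡ _ _ gw)))))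
    from-label : (d v ≤ᵇ suc k) ≡ true → (inBall G u k v ∨ any grows (verts G)) ≡ true
    from-label e with d v ≤? k
    ... | yes dv≤k = ∨-trueˡ _ _ (trans (inBall-labelling k v v<) (≤ᵇ-complete (d v) dv≤k))
    ... | no  dv≰k with descent v k v< (≤-antisym (≤ᵇ-sound e) (≰⇒> dv≰k))
    ...   | w , w< , w~v , dw = ∨-trueʳ _ _ (any-intro grows (λ z → z) (N G) w w<
              (subst (λ b → (b ∧ adj G w v) ≡ true)
                     (sym (trans (inBall-labelling k w w<) (≤ᵇ-complete (d w) (≤-reflexive dw)))) w~v))

  dist-labelling : ∀ v → v < N G → d v < N G → dist G u v ≡ d v
  dist-labelling v v< dv< = firstTrue-least (N G) (λ k → inBall G u k v) (d v) dv<
    (λ k k< → trans (inBall-labelling k v v<) (≤ᵇ-false (d v) k<))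
    (trans (inBall-labelling (d v) v v<) (≤ᵇ-complete (d v) ≤-refl))

wiener-∑ : ∀ G → wiener G ≡ ∑ (N G) (λ v → ∑ v (λ u → dist G u v))
wiener-∑ G = trans (sum-concatMap (λ v → map (λ u → dist G u v) (upTo v)) (upTo (N G)))
  (trans (sum-applyUpTo _ (λ z → z) (N G)) (∑-cong (N G) (λ v _ → sum-applyUpTo _ (λ z → z) v)))

dist-self : ∀ G v → dist G v v ≡ 0
dist-self G v with N G
... | zero  = refl
... | suc _ rewrite ≡ᵇ-refl v = refl

SymmetricDist : Graph → Set
SymmetricDist G = ∀ u v → u < N G → v < N G → dist G u v ≡ dist G v u

wiener-ordered : ∀ G → SymmetricDist G →
                 wiener G + wiener G ≡ ∑ᶠ {N G} (λ v → ∑ᶠ {N G} (λ u → dist G (toℕ u) (toℕ v)))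
wiener-ordered G symm = begin
    wiener G + wiener G
  ≡⟨ cong₂ _+_ (wiener-∑ G) (wiener-∑ G) ⟩
    ∑ (N G) (λ v → ∑ v (λ u → dist G u v)) + ∑ (N G) (λ v → ∑ v (λ u → dist G u v))
  ≡⟨ sym (∑²-symmetric (N G) (dist G) symm (λ v _ → dist-self G v)) ⟩
    ∑ (N G) (λ v → ∑ (N G) (λ u → dist G u v))
  ≡⟨ ∑-cong (N G) (λ v _ → ∑-∑ᶠ (N G) (λ u → dist G u v)) ⟩
    ∑ (N G) (λ v → ∑ᶠ {N G} (λ u → dist G (toℕ u) v))
  ≡⟨ ∑-∑ᶠ (N G) (λ v → ∑ᶠ {N G} (λ u → dist G (toℕ u) v)) ⟩
    ∑ᶠ {N G} (λ v → ∑ᶠ {N G} (λ u → dist G (toℕ u) (toℕ v)))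
  ∎
  where open ≡-Reasoning

module _ {G H : Graph} (iso : G ≅ H) where
  private
    to : Fin (N G) → Fin (N H)
    to = Inverse.to (proj₁ iso)
    from : Fin (N H) → Fin (N G)
    from = Inverse.from (proj₁ iso)
    to∘from : ∀ y → to (from y) ≡ y
    to∘from = Inverse.strictlyInverseˡ (proj₁ iso)
    from∘to : ∀ x → from (to x) ≡ x
    from∘to = Inverse.strictlyInverseʳ (proj₁ iso)
    preserves : ∀ x y → adj G (toℕ x) (toℕ y) ≡ adj H (toℕ (to x)) (toℕ (to y))
    preserves = proj₂ iso

  vertexCount-≅ : N G ≡ N H
  vertexCount-≅ = cantor-schröder-bernstein
    (λ {x} {y} e → trans (sym (from∘to x)) (trans (cong from e) (from∘to y)))
    (λ {x} {y} e → trans (sym (to∘from x)) (trans (cong to e) (to∘from y)))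

  inBall-≅ : ∀ k x y → inBall G (toℕ x) k (toℕ y) ≡ inBall H (toℕ (to x)) k (toℕ (to y))
  inBall-≅ zero x y = bool-ext forward backward
    where
    forward : (toℕ x ≡ᵇ toℕ y) ≡ true → (toℕ (to x) ≡ᵇ toℕ (to y)) ≡ true
    forward e rewrite toℕ-injective {_} {x} {y} (≡ᵇ-sound e) = ≡ᵇ-refl (toℕ (to y))
    backward : (toℕ (to x) ≡ᵇ toℕ (to y)) ≡ true → (toℕ x ≡ᵇ toℕ y) ≡ true
    backward e = subst (λ z → (toℕ x ≡ᵇ toℕ z) ≡ true) x≡y (≡ᵇ-refl (toℕ x))
      where
      x≡y : x ≡ y
      x≡y = trans (sym (from∘to x)) (trans (cong from (toℕ-injective (≡ᵇ-sound e))) (from∘to y))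
  inBall-≅ (suc k) x y = cong₂ _∨_ (inBall-≅ k x y) (bool-ext forward backward)
    where
    growsG : ℕ → Bool
    growsG w = inBall G (toℕ x) k w ∧ adj G w (toℕ y)
    growsH : ℕ → Bool
    growsH w = inBall H (toℕ (to x)) k w ∧ adj H w (toℕ (to y))
    grows-≅ : ∀ i → growsG (toℕ i) ≡ growsH (toℕ (to i))
    grows-≅ i = cong₂ _∧_ (inBall-≅ k x i) (preserves i y)
    forward : any growsG (verts G) ≡ true → any growsH (verts H) ≡ true
    forward e with any-elim growsG (λ z → z) (N G) e
    ... | w , w< , gw = any-intro growsH (λ z → z) (N H) (toℕ (to i)) (toℕ<n (to i))
                          (trans (sym (grows-≅ i)) (trans (cong growsG (toℕ-fromℕ< w<)) gw))
      where
      i : Fin (N G)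
      i = fromℕ< w<
    backward : any growsH (verts H) ≡ true → any growsG (verts G) ≡ true
    backward e with any-elim growsH (λ z → z) (N H) e
    ... | w , w< , hw = any-intro growsG (λ z → z) (N G) (toℕ (from j)) (toℕ<n (from j))
                          (trans (grows-≅ (from j)) (trans (cong (growsH ∘ toℕ) (to∘from j)) (trans (cong growsH (toℕ-fromℕ< w<)) hw)))
      where
      j : Fin (N H)
      j = fromℕ< w<

  dist-≅ : ∀ x y → dist G (toℕ x) (toℕ y) ≡ dist H (toℕ (to x)) (toℕ (to y))
  dist-≅ x y = trans (cong (λ b → firstTrue b (λ k → inBall G (toℕ x) k (toℕ y))) vertexCount-≅)
                     (firstTrue-cong (N H) (λ k → inBall-≅ k x y))
    where
    firstTrue-cong : ∀ b {p q : ℕ → Bool} → (∀ k → p k ≡ q k) → firstTrue b p ≡ firstTrue b q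
    firstTrue-cong zero    p≡q = refl
    firstTrue-cong (suc b) {q = q} p≡q rewrite p≡q 0 =
      cong (λ z → if q 0 then 0 else suc z) (firstTrue-cong b (p≡q ∘ suc))

  wiener-≅ : SymmetricDist G → SymmetricDist H → wiener G ≡ wiener H
  wiener-≅ symG symH = +-cancel-double (begin
      wiener G + wiener G
    ≡⟨ wiener-ordered G symG ⟩
      ∑ᶠ {N G} (λ v → ∑ᶠ {N G} (λ u → dist G (toℕ u) (toℕ v)))
    ≡⟨ sum-cong-≗ (λ v → sum-cong-≗ (λ u → dist-≅ u v)) ⟩
      ∑ᶠ {N G} (λ v → ∑ᶠ {N G} (λ u → dist H (toℕ (to u)) (toℕ (to v))))
    ≡⟨ sum-cong-≗ (λ v → sym (sum-permute (λ u′ → dist H (toℕ u′) (toℕ (to v))) (proj₁ iso))) ⟩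
      ∑ᶠ {N G} (λ v → ∑ᶠ {N H} (λ u′ → dist H (toℕ u′) (toℕ (to v))))
    ≡⟨ sym (sum-permute (λ v′ → ∑ᶠ {N H} (λ u′ → dist H (toℕ u′) (toℕ v′))) (proj₁ iso)) ⟩
      ∑ᶠ {N H} (λ v′ → ∑ᶠ {N H} (λ u′ → dist H (toℕ u′) (toℕ v′)))
    ≡⟨ sym (wiener-ordered H symH) ⟩
      wiener H + wiener H
    ∎)
    where
    open ≡-Reasoning
    +-cancel-double : ∀ {m n} → m + m ≡ n + n → m ≡ n
    +-cancel-double {m} {n} e = *-cancelˡ-≡ m n 2 (trans (cong (m +_) (+-identityʳ m)) (trans e (sym (cong (n +_) (+-identityʳ n)))))

-- a boolean property of 0 … n-1, to be verified by evaluation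
allBelow : ℕ → (ℕ → Bool) → Bool
allBelow zero    p = true
allBelow (suc n) p = p 0 ∧ allBelow n (p ∘ suc)

allBelow-sound : ∀ n p → allBelow n p ≡ true → ∀ j → j < n → p j ≡ true
allBelow-sound (suc n) p e zero    _         = ∧-trueˡ (p 0) _ e
allBelow-sound (suc n) p e (suc j) (s≤s j<n) = allBelow-sound n (p ∘ suc) (∧-trueʳ (p 0) _ e) j j<n

hexagonCheck : (q : ℕ → ℕ → Bool) → allBelow 6 (λ a → allBelow 6 (q a)) ≡ true →
               ∀ i j → i < 6 → j < 6 → q i j ≡ true
hexagonCheck q e i j i< j< = allBelow-sound 6 (q i) (allBelow-sound 6 (λ a → allBelow 6 (q a)) e i i<) j j<

hexDist : ℕ → ℕ → ℕ
hexDist i j = ∣ i - j ∣ ⊓ (6 ∸ ∣ i - j ∣)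

next : ℕ → ℕ
next j = suc j % 6

prev : ℕ → ℕ
prev j = (j + 5) % 6

next<6 : ∀ j → next j < 6
next<6 j = m%n<n (suc j) 6

hexDist-sym : ∀ i j → hexDist i j ≡ hexDist j i
hexDist-sym i j rewrite ∣-∣-comm i j = refl

hexDist-self : ∀ i → hexDist i i ≡ 0
hexDist-self i rewrite ∣n-n∣≡0 i = refl

hexDist≤3 : ∀ i j → hexDist i j ≤ 3
hexDist≤3 i j with ∣ i - j ∣
... | 0 = z≤n
... | 1 = s≤s z≤n
... | 2 = s≤s (s≤s z≤n)
... | 3 = s≤s (s≤s (s≤s z≤n))
... | suc (suc (suc (suc d))) = ≤-trans (m⊓n≤n _ (2 ∸ d)) (≤-trans (m∸n≤m 2 d) (s≤s (s≤s z≤n)))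

hexDist-positive : ∀ i j → i < 6 → j < 6 → (i ≡ j) ⊎ (1 ≤ hexDist i j)
hexDist-positive i j i< j< with ∨-true (i ≡ᵇ j) _ (hexagonCheck (λ i j → (i ≡ᵇ j) ∨ (1 ≤ᵇ hexDist i j)) refl i j i< j<)
... | inj₁ i≡j = inj₁ (≡ᵇ-sound i≡j)
... | inj₂ pos = inj₂ (≤ᵇ-sound pos)

hexDist-zero : ∀ i j → i < 6 → j < 6 → hexDist i j ≡ 0 → i ≡ j
hexDist-zero i j i< j< d≡0 with hexDist-positive i j i< j<
... | inj₁ i≡j = i≡j
... | inj₂ pos = ⊥-elim (<⇒≢ pos (sym d≡0))

hexDist-next : ∀ e x → e < 6 → x < 6 → hexDist e (next x) ≤ suc (hexDist e x)
hexDist-next e x e< x< = ≤ᵇ-sound (hexagonCheck (λ e x → hexDist e (next x) ≤ᵇ suc (hexDist e x)) refl e x e< x<)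

hexDist-prev : ∀ e x → e < 6 → x < 6 → hexDist e x ≤ suc (hexDist e (next x))
hexDist-prev e x e< x< = ≤ᵇ-sound (hexagonCheck (λ e x → hexDist e x ≤ᵇ suc (hexDist e (next x))) refl e x e< x<)

towards : ℕ → ℕ → ℕ
towards e j = if hexDist e (next j) <ᵇ hexDist e j then next j else prev j

towards<6 : ∀ e j → towards e j < 6
towards<6 e j with hexDist e (next j) <ᵇ hexDist e j
... | true  = next<6 j
... | false = m%n<n (j + 5) 6

towards-adjacent : ∀ e j → j < 6 → (towards e j ≡ next j) ⊎ (j ≡ next (towards e j))
towards-adjacent e j j< with hexDist e (next j) <ᵇ hexDist e j
... | true  = inj₁ refl
... | false = inj₂ (sym (≡ᵇ-sound (allBelow-sound 6 (λ j → next (prev j) ≡ᵇ j) refl j j<)))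

towards-closer : ∀ e j → e < 6 → j < 6 → 1 ≤ hexDist e j → suc (hexDist e (towards e j)) ≡ hexDist e j
towards-closer e j e< j< pos with ∨-true (hexDist e j ≡ᵇ 0) _
       (hexagonCheck (λ e j → (hexDist e j ≡ᵇ 0) ∨ (suc (hexDist e (towards e j)) ≡ᵇ hexDist e j)) refl e j e< j<)
... | inj₁ at-e = ⊥-elim (<⇒≢ pos (sym (≡ᵇ-sound at-e)))
... | inj₂ step = ≡ᵇ-sound step

-- the reflection of the hexagon exchanging positions 0 and p
mirror : ℕ → ℕ → ℕ
mirror p j = (p + 6 ∸ j) % 6

mirror<6 : ∀ p j → mirror p j < 6
mirror<6 p j = m%n<n (p + 6 ∸ j) 6

mirror-involutive : ∀ p j → p < 6 → j < 6 → mirror p (mirror p j) ≡ j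
mirror-involutive p j p< j< = ≡ᵇ-sound (hexagonCheck (λ p j → mirror p (mirror p j) ≡ᵇ j) refl p j p< j<)

mirror-next : ∀ p j → p < 6 → j < 6 → mirror p j ≡ next (mirror p (next j))
mirror-next p j p< j< = ≡ᵇ-sound (hexagonCheck (λ p j → mirror p j ≡ᵇ next (mirror p (next j))) refl p j p< j<)

mirror-0 : ∀ p → p < 6 → mirror p 0 ≡ p
mirror-0 p p< = ≡ᵇ-sound (allBelow-sound 6 (λ p → mirror p 0 ≡ᵇ p) refl p p<)

mirror-self : ∀ p → p < 6 → mirror p p ≡ 0
mirror-self p p< = ≡ᵇ-sound (allBelow-sound 6 (λ p → mirror p p ≡ᵇ 0) refl p p<)

nextCut≤3 : ∀ s k → nextCut s k ≤ 3
nextCut≤3 s zero = z≤n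
nextCut≤3 [] (suc k) = z≤n
nextCut≤3 (ortho ∷ s) (suc zero) = s≤s z≤n
nextCut≤3 (meta ∷ s) (suc zero) = s≤s (s≤s z≤n)
nextCut≤3 (para ∷ s) (suc zero) = s≤s (s≤s (s≤s z≤n))
nextCut≤3 (x ∷ s) (suc (suc k)) = nextCut≤3 s (suc k)

nextCut<6 : ∀ s k → nextCut s k < 6
nextCut<6 s k = s≤s (≤-trans (nextCut≤3 s k) (s≤s (s≤s (s≤s z≤n))))

nextCut-positive : ∀ s k → 1 ≤ k → k ≤ length s → 1 ≤ nextCut s k
nextCut-positive (ortho ∷ s) (suc zero) _ _ = s≤s z≤n
nextCut-positive (meta ∷ s) (suc zero) _ _ = s≤s z≤n
nextCut-positive (para ∷ s) (suc zero) _ _ = s≤s z≤n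
nextCut-positive (x ∷ s) (suc (suc k)) _ (s≤s k≤) = nextCut-positive s (suc k) (s≤s z≤n) k≤

hexCount-positive : ∀ s → 1 ≤ hexCount s
hexCount-positive s = ≤-trans (s≤s z≤n) (m≤n+m 2 (length s))

quotRem5 : ℕ → ℕ × ℕ
quotRem5 (suc (suc (suc (suc (suc y))))) = suc (proj₁ (quotRem5 y)) , proj₂ (quotRem5 y)
quotRem5 y = 0 , y

quotRem5-spec : ∀ y → (proj₁ (quotRem5 y) * 5 + proj₂ (quotRem5 y) ≡ y) × proj₂ (quotRem5 y) < 5
quotRem5-spec 0 = refl , s≤s z≤n
quotRem5-spec 1 = refl , s≤s (s≤s z≤n)
quotRem5-spec 2 = refl , s≤s (s≤s (s≤s z≤n))
quotRem5-spec 3 = refl , s≤s (s≤s (s≤s (s≤s z≤n)))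
quotRem5-spec 4 = refl , s≤s (s≤s (s≤s (s≤s (s≤s z≤n))))
quotRem5-spec (suc (suc (suc (suc (suc y))))) =
  cong (5 +_) (proj₁ (quotRem5-spec y)) , proj₂ (quotRem5-spec y)

quotRem5-unique : ∀ q r → r < 5 → quotRem5 (q * 5 + r) ≡ (q , r)
quotRem5-unique zero 0 _ = refl
quotRem5-unique zero 1 _ = refl
quotRem5-unique zero 2 _ = refl
quotRem5-unique zero 3 _ = refl
quotRem5-unique zero 4 _ = refl
quotRem5-unique zero (suc (suc (suc (suc (suc r))))) (s≤s (s≤s (s≤s (s≤s (s≤s ())))))
quotRem5-unique (suc q) r r<5 rewrite quotRem5-unique q r r<5 = refl

-- the hexagon containing vertex x (the later one for a cut vertex) and x's position in it
hexOf : ℕ → ℕ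
hexOf (suc (suc (suc (suc (suc (suc y)))))) = suc (proj₁ (quotRem5 y))
hexOf _ = 0

posOf : ℕ → ℕ
posOf (suc (suc (suc (suc (suc (suc y)))))) = suc (proj₂ (quotRem5 y))
posOf x = x

vid-new : ∀ s k j → vid s (suc k) (suc j) ≡ 6 + (k * 5 + j)
vid-new s k j rewrite *-comm k 5 = refl

hexOf-new : ∀ s k j → j < 5 → hexOf (vid s (suc k) (suc j)) ≡ suc k
hexOf-new s k j j<5 = trans (cong hexOf (vid-new s k j)) (cong (suc ∘ proj₁) (quotRem5-unique k j j<5))

posOf-new : ∀ s k j → j < 5 → posOf (vid s (suc k) (suc j)) ≡ suc j
posOf-new s k j j<5 = trans (cong posOf (vid-new s k j)) (cong (suc ∘ proj₂) (quotRem5-unique k j j<5))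

hexOf-first : ∀ s j → j < 6 → hexOf (vid s 0 j) ≡ 0
hexOf-first s j j<6 = ≡ᵇ-sound (allBelow-sound 6 (λ j → hexOf j ≡ᵇ 0) refl j j<6)

posOf-first : ∀ s j → j < 6 → posOf (vid s 0 j) ≡ j
posOf-first s j j<6 = ≡ᵇ-sound (allBelow-sound 6 (λ j → posOf j ≡ᵇ j) refl j j<6)

vid-coordinates : ∀ s x → vid s (hexOf x) (posOf x) ≡ x
vid-coordinates s (suc (suc (suc (suc (suc (suc y)))))) =
  trans (vid-new s (proj₁ (quotRem5 y)) (proj₂ (quotRem5 y))) (cong (6 +_) (proj₁ (quotRem5-spec y)))
vid-coordinates s 0 = refl
vid-coordinates s 1 = refl
vid-coordinates s 2 = refl
vid-coordinates s 3 = refl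
vid-coordinates s 4 = refl
vid-coordinates s 5 = refl

posOf<6 : ∀ x → posOf x < 6
posOf<6 (suc (suc (suc (suc (suc (suc y)))))) = s≤s (proj₂ (quotRem5-spec y))
posOf<6 0 = s≤s z≤n
posOf<6 1 = s≤s (s≤s z≤n)
posOf<6 2 = s≤s (s≤s (s≤s z≤n))
posOf<6 3 = s≤s (s≤s (s≤s (s≤s z≤n)))
posOf<6 4 = s≤s (s≤s (s≤s (s≤s (s≤s z≤n))))
posOf<6 5 = s≤s (s≤s (s≤s (s≤s (s≤s (s≤s z≤n)))))

-- outside H_0 the position 0 is never used, since it names a cut vertex
posOf-positive : ∀ x → 1 ≤ hexOf x → 1 ≤ posOf x
posOf-positive (suc (suc (suc (suc (suc (suc y)))))) _ = s≤s z≤n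

hexOf< : ∀ x h → 1 ≤ h → x < 5 * h + 1 → hexOf x < h
hexOf< (suc (suc (suc (suc (suc (suc y)))))) h _ x< =
  *-cancelˡ-< 5 (suc q) h (≤-trans (s≤s 5q+5≤y+5) (≤-pred (≤-trans x< (≤-reflexive (+-comm (5 * h) 1)))))
  where
  q : ℕ
  q = proj₁ (quotRem5 y)
  r : ℕ
  r = proj₂ (quotRem5 y)
  5q+5≤y+5 : 5 * suc q ≤ 5 + y
  5q+5≤y+5 = ≤-trans (≤-reflexive (*-suc 5 q))
               (+-monoʳ-≤ 5 (≤-trans (≤-reflexive (*-comm 5 q)) (≤-trans (m≤m+n (q * 5) r) (≤-reflexive (proj₁ (quotRem5-spec y))))))
hexOf< 0 h 1≤h _ = 1≤h
hexOf< 1 h 1≤h _ = 1≤h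
hexOf< 2 h 1≤h _ = 1≤h
hexOf< 3 h 1≤h _ = 1≤h
hexOf< 4 h 1≤h _ = 1≤h
hexOf< 5 h 1≤h _ = 1≤h

hexOf<hexCount : ∀ s x → x < N (chain s) → hexOf x < hexCount s
hexOf<hexCount s x = hexOf< x (hexCount s) (hexCount-positive s)

vid≤ : ∀ s k j → j < 6 → vid s k j ≤ 5 * k + 5
vid≤ s zero j j<6 = ≤-pred j<6
vid≤ s (suc k) zero _ =
  ≤-trans (vid≤ s k (nextCut s k) (nextCut<6 s k)) (≤-trans (m≤n+m _ 5) (≤-reflexive (shift k)))
  where
  shift : ∀ k → 5 + (5 * k + 5) ≡ 5 * suc k + 5
  shift = solve-∀
vid≤ s (suc k) (suc j) (s≤s j<5) =
  ≤-trans (≤-reflexive (vid-new s k j)) (≤-trans (+-monoʳ-≤ 6 (+-monoʳ-≤ (k * 5) (≤-pred j<5))) (≤-reflexive (shift k)))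
  where
  shift : ∀ k → 6 + (k * 5 + 4) ≡ 5 * suc k + 5
  shift = solve-∀

vid<N : ∀ s k j → k < hexCount s → j < 6 → vid s k j < N (chain s)
vid<N s k j k< j<6 =
  ≤-trans (s≤s (≤-trans (vid≤ s k j j<6) (≤-trans (≤-reflexive (shift k)) (*-monoʳ-≤ 5 k<)))) (≤-reflexive (+-comm 1 _))
  where
  shift : ∀ k → 5 * k + 5 ≡ 5 * suc k
  shift = solve-∀

Edge : List Pos → ℕ → ℕ → ℕ → ℕ → Set
Edge s k j w v = ((w ≡ vid s k j) × (v ≡ vid s k (next j))) ⊎ ((v ≡ vid s k j) × (w ≡ vid s k (next j)))

edgeTest : List Pos → ℕ → ℕ → ℕ → ℕ → Bool
edgeTest s k j x y = ((vid s k j ≡ᵇ x) ∧ (vid s k (next j) ≡ᵇ y)) ∨ ((vid s k j ≡ᵇ y) ∧ (vid s k (next j) ≡ᵇ x))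

adj-edge : ∀ s w v → adj (chain s) w v ≡ true →
           Σ ℕ λ k → Σ ℕ λ j → k < hexCount s × j < 6 × Edge s k j w v
adj-edge s w v e with any-elim (λ k → any (λ j → edgeTest s k j w v) (upTo 6)) (λ z → z) (hexCount s) e
... | k , k< , e′ with any-elim (λ j → edgeTest s k j w v) (λ z → z) 6 e′
... | j , j< , e″ = k , j , k< , j< , orientation (∨-true _ _ e″)
  where
  orientation : (((vid s k j ≡ᵇ w) ∧ (vid s k (next j) ≡ᵇ v)) ≡ true) ⊎ (((vid s k j ≡ᵇ v) ∧ (vid s k (next j) ≡ᵇ w)) ≡ true) →
                Edge s k j w v
  orientation (inj₁ p) = inj₁ (sym (≡ᵇ-sound (∧-trueˡ _ _ p)) , sym (≡ᵇ-sound (∧-trueʳ (vid s k j ≡ᵇ w) _ p)))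
  orientation (inj₂ p) = inj₂ (sym (≡ᵇ-sound (∧-trueˡ _ _ p)) , sym (≡ᵇ-sound (∧-trueʳ (vid s k j ≡ᵇ v) _ p)))

edge-adj : ∀ s k j w v → k < hexCount s → j < 6 → Edge s k j w v → adj (chain s) w v ≡ true
edge-adj s k j w v k< j< edge =
  any-intro (λ k → any (λ j → edgeTest s k j w v) (upTo 6)) (λ z → z) (hexCount s) k k<
    (any-intro (λ j → edgeTest s k j w v) (λ z → z) 6 j j< (test edge))
  where
  test : Edge s k j w v → edgeTest s k j w v ≡ true
  test (inj₁ (refl , refl)) rewrite ≡ᵇ-refl (vid s k j) | ≡ᵇ-refl (vid s k (next j)) = refl
  test (inj₂ (refl , refl)) rewrite ≡ᵇ-refl (vid s k j) | ≡ᵇ-refl (vid s k (next j)) = ∨-trueʳ _ _ refl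

-- The distance formula in a chain

-- spine s k = d(c_1, c_k) for k ≥ 1: the cut vertices are joined by shortest paths
-- through the hexagons between them
spine : List Pos → ℕ → ℕ
spine s zero    = 0
spine s (suc t) = spine s t + hexDist 0 (nextCut s t)

spine-mono : ∀ s {m n} → m ≤ n → spine s m ≤ spine s n
spine-mono s {n = zero}  z≤n = z≤n
spine-mono s {m} {suc n} m≤ with m ≟ suc n
... | yes refl = ≤-refl
... | no  m≢   = ≤-trans (spine-mono s (≤-pred (≤∧≢⇒< m≤ m≢))) (m≤m+n _ _)

spine≤ : ∀ s n → spine s n ≤ 3 * n
spine≤ s zero    = z≤n
spine≤ s (suc n) = ≤-trans (+-mono-≤ (spine≤ s n) (hexDist≤3 0 (nextCut s n))) (≤-reflexive (shift n))
  where
  shift : ∀ n → 3 * n + 3 ≡ 3 * suc n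
  shift = solve-∀

-- choose one of three values according to whether k is before, at or after a
-- (kept abstract: it is only ever used through the three equations below)
abstract
  bySide : ℕ → ℕ → ℕ → ℕ → ℕ → ℕ
  bySide k a x y z with <-cmp k a
  ... | tri< _ _ _ = x
  ... | tri≈ _ _ _ = y
  ... | tri> _ _ _ = z

  bySide-before : ∀ {k a} x y z → k < a → bySide k a x y z ≡ x
  bySide-before {k} {a} x y z k<a with <-cmp k a
  ... | tri< _ _ _   = refl
  ... | tri≈ _ k≡a _ = ⊥-elim (<-irrefl k≡a k<a)
  ... | tri> _ _ a<k = ⊥-elim (<-asym k<a a<k)

  bySide-at : ∀ {k a} x y z → k ≡ a → bySide k a x y z ≡ y
  bySide-at {k} {a} x y z k≡a with <-cmp k a
  ... | tri< k<a _ _ = ⊥-elim (<-irrefl k≡a k<a)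
  ... | tri≈ _ _ _   = refl
  ... | tri> _ _ a<k = ⊥-elim (<-irrefl (sym k≡a) a<k)

  bySide-after : ∀ {k a} x y z → a < k → bySide k a x y z ≡ z
  bySide-after {k} {a} x y z a<k with <-cmp k a
  ... | tri< k<a _ _ = ⊥-elim (<-asym k<a a<k)
  ... | tri≈ _ k≡a _ = ⊥-elim (<-irrefl (sym k≡a) a<k)
  ... | tri> _ _ _   = refl

module _ (s : List Pos) (u : ℕ) where
  private
    a : ℕ
    a = hexOf u
    p : ℕ
    p = posOf u

  -- the vertex through which every shortest path from u enters H_k, as a position of H_k:
  -- c_{k+1} for hexagons before u's, u itself in u's hexagon, c_k after it
  entry : ℕ → ℕ
  entry k = bySide k a (nextCut s k) p 0

  -- the distance from u to that entry vertex
  offset : ℕ → ℕ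
  offset k = bySide k a (hexDist 0 p + (spine s a ∸ spine s (suc k))) 0
                        (hexDist p (nextCut s a) + (spine s k ∸ spine s (suc a)))

  distIn : ℕ → ℕ → ℕ
  distIn k j = offset k + hexDist (entry k) j

  entry-before : ∀ k → k < a → entry k ≡ nextCut s k
  entry-before k k<a = bySide-before _ _ _ k<a

  entry-at : ∀ k → k ≡ a → entry k ≡ p
  entry-at k k≡a = bySide-at _ _ _ k≡a

  entry-after : ∀ k → a < k → entry k ≡ 0
  entry-after k a<k = bySide-after _ _ _ a<k

  entry<6 : ∀ k → entry k < 6
  entry<6 k with <-cmp k a
  ... | tri< k<a _ _ = subst (_< 6) (sym (entry-before k k<a)) (nextCut<6 s k)
  ... | tri≈ _ k≡a _ = subst (_< 6) (sym (entry-at k k≡a)) (posOf<6 u)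
  ... | tri> _ _ a<k = subst (_< 6) (sym (entry-after k a<k)) z<s

  distIn-before : ∀ k j → k < a → distIn k j ≡ hexDist 0 p + (spine s a ∸ spine s (suc k)) + hexDist (nextCut s k) j
  distIn-before k j k<a = cong₂ (λ o e → o + hexDist e j) (bySide-before _ _ _ k<a) (entry-before k k<a)

  distIn-at : ∀ k j → k ≡ a → distIn k j ≡ hexDist p j
  distIn-at k j k≡a = cong₂ (λ o e → o + hexDist e j) (bySide-at _ _ _ k≡a) (entry-at k k≡a)

  distIn-after : ∀ k j → a < k → distIn k j ≡ hexDist p (nextCut s a) + (spine s k ∸ spine s (suc a)) + hexDist 0 j
  distIn-after k j a<k = cong₂ (λ o e → o + hexDist e j) (bySide-after _ _ _ a<k) (entry-after k a<k)

  -- The cut vertex c_{k+1} is position nextCut s k of H_k and position 0 of H_{k+1};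
  -- both descriptions give it the same distance, in each of the three regimes.
  private
    cut-before-last : ∀ k → k < a → suc k ≡ a → distIn (suc k) 0 ≡ distIn k (nextCut s k)
    cut-before-last k k<a sk≡a = begin
        distIn (suc k) 0
      ≡⟨ distIn-at (suc k) 0 sk≡a ⟩
        hexDist p 0
      ≡⟨ hexDist-sym p 0 ⟩
        hexDist 0 p
      ≡⟨ sym (trans (+-identityʳ _) (+-identityʳ _)) ⟩
        hexDist 0 p + 0 + 0
      ≡⟨ cong₂ (λ x y → hexDist 0 p + x + y) (sym spine-gap) (sym (hexDist-self c)) ⟩
        hexDist 0 p + (spine s a ∸ spine s (suc k)) + hexDist c c
      ≡⟨ sym (distIn-before k c k<a) ⟩
        distIn k c
      ∎
      where
      open ≡-Reasoning
      c : ℕ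
      c = nextCut s k
      spine-gap : spine s a ∸ spine s (suc k) ≡ 0
      spine-gap = trans (cong (λ b → spine s b ∸ spine s (suc k)) (sym sk≡a)) (n∸n≡0 (spine s (suc k)))

    cut-before-inner : ∀ k → k < a → suc k < a → distIn (suc k) 0 ≡ distIn k (nextCut s k)
    cut-before-inner k k<a sk<a = begin
        distIn (suc k) 0
      ≡⟨ distIn-before (suc k) 0 sk<a ⟩
        hexDist 0 p + (spine s a ∸ (spine s (suc k) + step)) + hexDist (nextCut s (suc k)) 0
      ≡⟨ cong (hexDist 0 p + (spine s a ∸ (spine s (suc k) + step)) +_) (hexDist-sym (nextCut s (suc k)) 0) ⟩
        hexDist 0 p + (spine s a ∸ (spine s (suc k) + step)) + step
      ≡⟨ +-assoc (hexDist 0 p) _ step ⟩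
        hexDist 0 p + (spine s a ∸ (spine s (suc k) + step) + step)
      ≡⟨ cong (hexDist 0 p +_) (∸-+-cancel (spine-mono s sk<a)) ⟩
        hexDist 0 p + (spine s a ∸ spine s (suc k))
      ≡⟨ sym (trans (cong (hexDist 0 p + (spine s a ∸ spine s (suc k)) +_) (hexDist-self c)) (+-identityʳ _)) ⟩
        hexDist 0 p + (spine s a ∸ spine s (suc k)) + hexDist c c
      ≡⟨ sym (distIn-before k c k<a) ⟩
        distIn k c
      ∎
      where
      open ≡-Reasoning
      c : ℕ
      c = nextCut s k
      step : ℕ
      step = hexDist 0 (nextCut s (suc k))
      ∸-+-cancel : spine s (suc k) + step ≤ spine s a →
                   spine s a ∸ (spine s (suc k) + step) + step ≡ spine s a ∸ spine s (suc k)
      ∸-+-cancel le = trans (cong (_+ step) (sym (∸-+-assoc (spine s a) (spine s (suc k)) step)))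
        (m∸n+n≡m (≤-trans (≤-reflexive (sym (m+n∸m≡n (spine s (suc k)) step))) (∸-monoˡ-≤ (spine s (suc k)) le)))

    cut-at : ∀ k → k ≡ a → distIn (suc k) 0 ≡ distIn k (nextCut s k)
    cut-at k k≡a = begin
        distIn (suc k) 0
      ≡⟨ distIn-after (suc k) 0 (≤-reflexive (cong suc (sym k≡a))) ⟩
        hexDist p (nextCut s a) + (spine s (suc k) ∸ spine s (suc a)) + 0
      ≡⟨ cong (λ b → hexDist p (nextCut s a) + (spine s (suc k) ∸ spine s (suc b)) + 0) (sym k≡a) ⟩
        hexDist p (nextCut s a) + (spine s (suc k) ∸ spine s (suc k)) + 0
      ≡⟨ cong (λ x → hexDist p (nextCut s a) + x + 0) (n∸n≡0 (spine s (suc k))) ⟩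
        hexDist p (nextCut s a) + 0 + 0
      ≡⟨ trans (+-identityʳ _) (+-identityʳ _) ⟩
        hexDist p (nextCut s a)
      ≡⟨ cong (λ b → hexDist p (nextCut s b)) (sym k≡a) ⟩
        hexDist p (nextCut s k)
      ≡⟨ sym (distIn-at k (nextCut s k) k≡a) ⟩
        distIn k (nextCut s k)
      ∎
      where open ≡-Reasoning

    cut-after : ∀ k → a < k → distIn (suc k) 0 ≡ distIn k (nextCut s k)
    cut-after k a<k = begin
        distIn (suc k) 0
      ≡⟨ distIn-after (suc k) 0 (m<n⇒m<1+n a<k) ⟩
        hexDist p (nextCut s a) + (spine s k + step ∸ spine s (suc a)) + 0
      ≡⟨ cong (λ x → hexDist p (nextCut s a) + x + 0) (+-∸-comm step (spine-mono s a<k)) ⟩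
        hexDist p (nextCut s a) + (spine s k ∸ spine s (suc a) + step) + 0
      ≡⟨ regroup (hexDist p (nextCut s a)) (spine s k ∸ spine s (suc a)) step ⟩
        hexDist p (nextCut s a) + (spine s k ∸ spine s (suc a)) + step
      ≡⟨ sym (distIn-after k (nextCut s k) a<k) ⟩
        distIn k (nextCut s k)
      ∎
      where
      open ≡-Reasoning
      step : ℕ
      step = hexDist 0 (nextCut s k)
      regroup : ∀ x y c → x + (y + c) + 0 ≡ x + y + c
      regroup = solve-∀

  distIn-cut : ∀ k → distIn (suc k) 0 ≡ distIn k (nextCut s k)
  distIn-cut k with <-cmp k a
  ... | tri< k<a _ _ with suc k ≟ a
  ...   | yes sk≡a = cut-before-last k k<a sk≡a
  ...   | no  sk≢a = cut-before-inner k k<a (≤∧≢⇒< k<a sk≢a)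
  distIn-cut k | tri≈ _ k≡a _ = cut-at k k≡a
  distIn-cut k | tri> _ _ a<k = cut-after k a<k

chainDist : List Pos → ℕ → ℕ → ℕ
chainDist s u v = distIn s u (hexOf v) (posOf v)

-- the candidate distance to the vertex at position j of H_k; at the cut vertices the two
-- descriptions agree by distIn-cut
chainDist-vid : ∀ s u k j → j < 6 → chainDist s u (vid s k j) ≡ distIn s u k j
chainDist-vid s u zero j j<6 = cong₂ (distIn s u) (hexOf-first s j j<6) (posOf-first s j j<6)
chainDist-vid s u (suc k) (suc j) (s≤s j<5) = cong₂ (distIn s u) (hexOf-new s k j j<5) (posOf-new s k j j<5)
chainDist-vid s u (suc k) zero _ =
  trans (chainDist-vid s u k (nextCut s k) (nextCut<6 s k)) (sym (distIn-cut s u k))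

away-from-cut : ∀ x → 1 ≤ hexOf x → 1 ≤ hexDist 0 (posOf x)
away-from-cut x 1≤hx with hexDist-positive 0 (posOf x) z<s (posOf<6 x)
... | inj₁ 0≡px = ⊥-elim (<⇒≢ (posOf-positive x 1≤hx) 0≡px)
... | inj₂ pos  = pos

chainDist-self : ∀ s u → chainDist s u u ≡ 0
chainDist-self s u = trans (distIn-at s u (hexOf u) (posOf u) refl) (hexDist-self (posOf u))

chainDist-zero : ∀ s u v → chainDist s u v ≡ 0 → u ≡ v
chainDist-zero s u v d≡0 with <-cmp (hexOf v) (hexOf u)
... | tri< hv<hu _ _ = ⊥-elim (<⇒≢ (≤-trans (away-from-cut u (≤-trans z<s hv<hu)) (≤-trans (m≤m+n _ _)
                         (≤-trans (m≤m+n _ _) (≤-reflexive (trans (sym (distIn-before s u (hexOf v) (posOf v) hv<hu)) d≡0))))) refl)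
... | tri≈ _ hv≡hu _ = begin
    u                              ≡⟨ sym (vid-coordinates s u) ⟩
    vid s (hexOf u) (posOf u)      ≡⟨ cong₂ (vid s) (sym hv≡hu) pu≡pv ⟩
    vid s (hexOf v) (posOf v)      ≡⟨ vid-coordinates s v ⟩
    v                              ∎
  where
  open ≡-Reasoning
  pu≡pv : posOf u ≡ posOf v
  pu≡pv = hexDist-zero (posOf u) (posOf v) (posOf<6 u) (posOf<6 v)
                       (trans (sym (distIn-at s u (hexOf v) (posOf v) hv≡hu)) d≡0)
... | tri> _ _ hu<hv = ⊥-elim (<⇒≢ (away-from-cut v (≤-trans z<s hu<hv))
                         (sym (m+n≡0⇒n≡0 _ (trans (sym (distIn-after s u (hexOf v) (posOf v) hu<hv)) d≡0))))

-- along an edge (inside some hexagon) the candidate distance changes by at most one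
chainDist-lipschitz : ∀ s u w v → adj (chain s) w v ≡ true → chainDist s u v ≤ suc (chainDist s u w)
chainDist-lipschitz s u w v w~v with adj-edge s w v w~v
... | k , j , k< , j< , inj₁ (refl , refl)
  rewrite chainDist-vid s u k j j< | chainDist-vid s u k (next j) (next<6 j) =
    ≤-trans (+-monoʳ-≤ (offset s u k) (hexDist-next (entry s u k) j (entry<6 s u k) j<)) (≤-reflexive (+-suc _ _))
... | k , j , k< , j< , inj₂ (refl , refl)
  rewrite chainDist-vid s u k j j< | chainDist-vid s u k (next j) (next<6 j) =
    ≤-trans (+-monoʳ-≤ (offset s u k) (hexDist-prev (entry s u k) j (entry<6 s u k) j<)) (≤-reflexive (+-suc _ _))

Closer : List Pos → ℕ → ℕ → ℕ → Set
Closer s u v m = Σ ℕ λ w → w < N (chain s) × adj (chain s) w v ≡ true × chainDist s u w ≡ m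

closer-in-hexagon : ∀ s u k j m → k < hexCount s → j < 6 → chainDist s u (vid s k j) ≡ suc m →
                    1 ≤ hexDist (entry s u k) j → Closer s u (vid s k j) m
closer-in-hexagon s u k j m k< j< d≡ pos =
  vid s k j′ , vid<N s k j′ k< (towards<6 e j) , edge (towards-adjacent e j j<) , d′≡
  where
  e : ℕ
  e = entry s u k
  j′ : ℕ
  j′ = towards e j
  d′≡ : chainDist s u (vid s k j′) ≡ m
  d′≡ = trans (chainDist-vid s u k j′ (towards<6 e j))
          (suc-injective (trans (sym (+-suc (offset s u k) _))
            (trans (cong (offset s u k +_) (towards-closer e j (entry<6 s u k) j< pos))
                   (trans (sym (chainDist-vid s u k j j<)) d≡))))
  edge : (j′ ≡ next j) ⊎ (j ≡ next j′) → adj (chain s) (vid s k j′) (vid s k j) ≡ true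
  edge (inj₁ j′≡) = edge-adj s k j _ _ k< j< (inj₂ (refl , cong (vid s k) j′≡))
  edge (inj₂ j≡)  = edge-adj s k j′ _ _ k< (towards<6 e j) (inj₁ (refl , cong (vid s k) j≡))

-- c_{k+1}, seen from a vertex u beyond H_k, is position 0 of H_{k+1} but not its entry point
closer-at-cut : ∀ s u k m → u < N (chain s) → k < hexOf u → chainDist s u (vid s (suc k) 0) ≡ suc m →
                Closer s u (vid s (suc k) 0) m
closer-at-cut s u k m u< k<hu d≡ =
  closer-in-hexagon s u (suc k) 0 m (≤-<-trans k<hu (hexOf<hexCount s u u<)) z<s d≡ (entry-off-cut (suc k ≟ hexOf u))
  where
  entry-off-cut : Dec (suc k ≡ hexOf u) → 1 ≤ hexDist (entry s u (suc k)) 0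
  entry-off-cut (yes sk≡hu) = subst (λ e → 1 ≤ hexDist e 0) (sym (entry-at s u (suc k) sk≡hu))
    (subst (1 ≤_) (hexDist-sym 0 (posOf u)) (away-from-cut u (≤-trans z<s k<hu)))
  entry-off-cut (no  sk≢hu) with hexDist-positive (nextCut s (suc k)) 0 (nextCut<6 s (suc k)) z<s
  ... | inj₂ pos = subst (λ e → 1 ≤ hexDist e 0) (sym (entry-before s u (suc k) (≤∧≢⇒< k<hu sk≢hu))) pos
  ... | inj₁ c≡0 = ⊥-elim (<⇒≢ (nextCut-positive s (suc k) (s≤s z≤n) sk≤len) (sym c≡0))
    where
    sk≤len : suc k ≤ length s
    sk≤len = ≤-pred (≤-trans (≤∧≢⇒< k<hu sk≢hu)
               (≤-pred (≤-trans (hexOf<hexCount s u u<) (≤-reflexive (+-comm (length s) 2)))))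

-- every vertex at positive candidate distance has a closer neighbour: inside its hexagon
-- when it is not the entry point, otherwise it is a cut vertex and we look in the next hexagon
chainDist-descent : ∀ s u v m → u < N (chain s) → v < N (chain s) → chainDist s u v ≡ suc m → Closer s u v m
chainDist-descent s u v m u< v< d≡
  with hexDist-positive (entry s u (hexOf v)) (posOf v) (entry<6 s u (hexOf v)) (posOf<6 v)
... | inj₂ pos = subst (λ x → Closer s u x m) (vid-coordinates s v)
                   (closer-in-hexagon s u (hexOf v) (posOf v) m (hexOf<hexCount s v v<) (posOf<6 v)
                     (trans (cong (chainDist s u) (vid-coordinates s v)) d≡) pos)
... | inj₁ entry≡pv with <-cmp (hexOf v) (hexOf u)
...   | tri≈ _ hv≡hu _ = ⊥-elim (0≢1+n (trans (sym d≡0) d≡))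
  where
  d≡0 : chainDist s u v ≡ 0
  d≡0 = trans (distIn-at s u (hexOf v) (posOf v) hv≡hu)
              (trans (cong (λ e → hexDist e (posOf v)) (trans (sym (entry-at s u (hexOf v) hv≡hu)) entry≡pv))
                     (hexDist-self (posOf v)))
...   | tri> _ _ hu<hv = ⊥-elim (<⇒≢ (posOf-positive v (≤-trans z<s hu<hv))
                                  (trans (sym (entry-after s u (hexOf v) hu<hv)) entry≡pv))
...   | tri< hv<hu _ _ = subst (λ x → Closer s u x m) v-is-cut
                           (closer-at-cut s u (hexOf v) m u< hv<hu (trans (cong (chainDist s u) v-is-cut) d≡))
  where
  v-is-cut : vid s (suc (hexOf v)) 0 ≡ v
  v-is-cut = trans (cong (vid s (hexOf v)) (trans (sym (entry-before s u (hexOf v) hv<hu)) entry≡pv)) (vid-coordinates s v)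

spine∸≤ : ∀ s a b → spine s a ∸ b ≤ 3 * a
spine∸≤ s a b = ≤-trans (m∸n≤m (spine s a) b) (spine≤ s a)

-- a path from u's hexagon to hexagon a < h: at most 3 steps at each end and 3 per hexagon between
path≤ : ∀ {x y z a h} → x ≤ 3 → y ≤ 3 * a → z ≤ 3 → a < h → x + y + z ≤ 3 * h + 3
path≤ {a = a} x≤ y≤ z≤ a<h =
  ≤-trans (+-mono-≤ (+-mono-≤ x≤ y≤) z≤) (≤-trans (≤-reflexive (regroup a)) (+-monoˡ-≤ 3 (*-monoʳ-≤ 3 a<h)))
  where
  regroup : ∀ a → 3 + 3 * a + 3 ≡ 3 * suc a + 3
  regroup = solve-∀

chainDist≤ : ∀ s u v → hexOf u < hexCount s → hexOf v < hexCount s → chainDist s u v ≤ 3 * hexCount s + 3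
chainDist≤ s u v hu< hv< with <-cmp (hexOf v) (hexOf u)
... | tri< hv<hu _ _ = subst (_≤ 3 * hexCount s + 3) (sym (distIn-before s u (hexOf v) (posOf v) hv<hu))
      (path≤ (hexDist≤3 0 (posOf u)) (spine∸≤ s (hexOf u) (spine s (suc (hexOf v)))) (hexDist≤3 (nextCut s (hexOf v)) (posOf v)) hu<)
... | tri≈ _ hv≡hu _ = subst (_≤ 3 * hexCount s + 3) (sym (distIn-at s u (hexOf v) (posOf v) hv≡hu))
      (≤-trans (hexDist≤3 (posOf u) (posOf v)) (m≤n+m 3 (3 * hexCount s)))
... | tri> _ _ hu<hv = subst (_≤ 3 * hexCount s + 3) (sym (distIn-after s u (hexOf v) (posOf v) hu<hv))
      (path≤ (hexDist≤3 (posOf u) (nextCut s (hexOf u))) (spine∸≤ s (hexOf v) (spine s (suc (hexOf u)))) (hexDist≤3 0 (posOf v)) hv<)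

chainDist<N : ∀ s u v → u < N (chain s) → v < N (chain s) → chainDist s u v < N (chain s)
chainDist<N s u v u< v< =
  ≤-<-trans (chainDist≤ s u v (hexOf<hexCount s u u<) (hexOf<hexCount s v v<)) (diameter<N (length s))
  where
  diameter<N : ∀ l → 3 * (l + 2) + 3 < 5 * (l + 2) + 1
  diameter<N l = ≤-trans (m≤m+n (suc (3 * (l + 2) + 3)) (2 * l + 1)) (≤-reflexive (regroup l))
    where
    regroup : ∀ l → suc (3 * (l + 2) + 3) + (2 * l + 1) ≡ 5 * (l + 2) + 1
    regroup = solve-∀

-- the candidate distance is symmetric: the path formula read backwards
chainDist-sym : ∀ s u v → chainDist s u v ≡ chainDist s v u
chainDist-sym s u v with <-cmp (hexOf v) (hexOf u)
... | tri< hv<hu _ _ = begin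
    chainDist s u v
  ≡⟨ distIn-before s u (hexOf v) (posOf v) hv<hu ⟩
    hexDist 0 (posOf u) + gap + hexDist (nextCut s (hexOf v)) (posOf v)
  ≡⟨ cong (λ x → hexDist 0 (posOf u) + gap + x) (hexDist-sym (nextCut s (hexOf v)) (posOf v)) ⟩
    hexDist 0 (posOf u) + gap + hexDist (posOf v) (nextCut s (hexOf v))
  ≡⟨ swap-ends (hexDist 0 (posOf u)) gap (hexDist (posOf v) (nextCut s (hexOf v))) ⟩
    hexDist (posOf v) (nextCut s (hexOf v)) + gap + hexDist 0 (posOf u)
  ≡⟨ sym (distIn-after s v (hexOf u) (posOf u) hv<hu) ⟩
    chainDist s v u
  ∎
  where
  open ≡-Reasoning
  gap : ℕ
  gap = spine s (hexOf u) ∸ spine s (suc (hexOf v))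
  swap-ends : ∀ x y z → x + y + z ≡ z + y + x
  swap-ends = solve-∀
... | tri≈ _ hv≡hu _ = begin
    chainDist s u v          ≡⟨ distIn-at s u (hexOf v) (posOf v) hv≡hu ⟩
    hexDist (posOf u) (posOf v) ≡⟨ hexDist-sym (posOf u) (posOf v) ⟩
    hexDist (posOf v) (posOf u) ≡⟨ sym (distIn-at s v (hexOf u) (posOf u) (sym hv≡hu)) ⟩
    chainDist s v u          ∎
  where open ≡-Reasoning
... | tri> _ _ hu<hv = begin
    chainDist s u v
  ≡⟨ distIn-after s u (hexOf v) (posOf v) hu<hv ⟩
    hexDist (posOf u) (nextCut s (hexOf u)) + gap + hexDist 0 (posOf v)
  ≡⟨ swap-ends (hexDist (posOf u) (nextCut s (hexOf u))) gap (hexDist 0 (posOf v)) ⟩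
    hexDist 0 (posOf v) + gap + hexDist (posOf u) (nextCut s (hexOf u))
  ≡⟨ cong (λ x → hexDist 0 (posOf v) + gap + x) (hexDist-sym (posOf u) (nextCut s (hexOf u))) ⟩
    hexDist 0 (posOf v) + gap + hexDist (nextCut s (hexOf u)) (posOf u)
  ≡⟨ sym (distIn-before s v (hexOf u) (posOf u) hu<hv) ⟩
    chainDist s v u
  ∎
  where
  open ≡-Reasoning
  gap : ℕ
  gap = spine s (hexOf v) ∸ spine s (suc (hexOf u))
  swap-ends : ∀ x y z → x + y + z ≡ z + y + x
  swap-ends = solve-∀

isDistanceFrom : ∀ s u → u < N (chain s) → IsDistanceFrom (chain s) u (chainDist s u)
isDistanceFrom s u u< = record
  { at-source   = chainDist-self s u
  ; only-source = chainDist-zero s u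
  ; lipschitz   = chainDist-lipschitz s u
  ; descent     = λ v m v< → chainDist-descent s u v m u< v<
  }

dist-chain : ∀ s u v → u < N (chain s) → v < N (chain s) → dist (chain s) u v ≡ chainDist s u v
dist-chain s u v u< v< = dist-labelling (isDistanceFrom s u u<) v v< (chainDist<N s u v u< v<)

symmetricDist-chain : ∀ s → SymmetricDist (chain s)
symmetricDist-chain s u v u< v< =
  trans (dist-chain s u v u< v<) (trans (chainDist-sym s u v) (sym (dist-chain s v u v< u<)))

-- The Wiener index of a chain, hexagon by hexagon

-- sum of the distances between the vertices of the first k hexagons H_0 … H_{k-1},
-- which are those numbered below 5k + 1
partialWiener : List Pos → ℕ → ℕ
partialWiener s k = ∑ (5 * k + 1) (λ v → ∑ v (λ u → chainDist s u v))

transmission : List Pos → ℕ → ℕ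
transmission s k = ∑ (5 * k + 1) (λ u → chainDist s u (vid s k 0))

wiener-partial : ∀ s → wiener (chain s) ≡ partialWiener s (hexCount s)
wiener-partial s = trans (wiener-∑ (chain s)) (∑-cong (N (chain s))
  (λ v v< → ∑-cong v (λ u u< → dist-chain s u v (<-trans u< v<) v<)))

first-hexagon : ∀ s u v → u < 6 → v < 6 → chainDist s u v ≡ hexDist u v
first-hexagon s u v u< v< = trans (distIn-at s u (hexOf v) (posOf v) (trans (hexOf-first s v v<) (sym (hexOf-first s u u<))))
                                  (cong₂ hexDist (posOf-first s u u<) (posOf-first s v v<))

transmission-1 : ∀ s → transmission s 1 ≡ 9
transmission-1 s = ∑-cong 6 (λ u u< → first-hexagon s u 0 u< z<s)

partialWiener-1 : ∀ s → partialWiener s 1 ≡ 27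
partialWiener-1 s = ∑-cong 6 (λ v v< → ∑-cong v (λ u u<v → first-hexagon s u v (<-trans u<v v<) v<))

new-vertex : ∀ s m t → 5 * suc m + 1 + t ≡ vid s (suc m) (suc t)
new-vertex s m t = renumber m t
  where
  renumber : ∀ m t → 5 * suc m + 1 + t ≡ 6 + 5 * m + t
  renumber = solve-∀

-- from an old vertex, paths to H_{m+1} pass through its cut vertex c_{m+1}
old-to-new : ∀ s m u j → u < 5 * suc m + 1 → j < 6 →
             chainDist s u (vid s (suc m) j) ≡ chainDist s u (vid s (suc m) 0) + hexDist 0 j
old-to-new s m u j u< j< = begin
    chainDist s u (vid s (suc m) j)
  ≡⟨ chainDist-vid s u (suc m) j j< ⟩
    distIn s u (suc m) j
  ≡⟨ distIn-after s u (suc m) j hu<sm ⟩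
    toCut + hexDist 0 j
  ≡⟨ cong (_+ hexDist 0 j) (sym (trans (distIn-after s u (suc m) 0 hu<sm) (+-identityʳ toCut))) ⟩
    distIn s u (suc m) 0 + hexDist 0 j
  ≡⟨ cong (_+ hexDist 0 j) (sym (chainDist-vid s u (suc m) 0 z<s)) ⟩
    chainDist s u (vid s (suc m) 0) + hexDist 0 j
  ∎
  where
  open ≡-Reasoning
  hu<sm : hexOf u < suc m
  hu<sm = hexOf< u (suc m) (s≤s z≤n) u<
  toCut : ℕ
  toCut = hexDist (posOf u) (nextCut s (hexOf u)) + (spine s (suc m) ∸ spine s (suc (hexOf u)))

within-new : ∀ s m t j → t < 5 → j < 6 → chainDist s (vid s (suc m) (suc t)) (vid s (suc m) j) ≡ hexDist (suc t) j
within-new s m t j t< j< =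
  trans (chainDist-vid s u (suc m) j j<)
        (trans (distIn-at s u (suc m) j (sym (hexOf-new s m t t<))) (cong (λ p → hexDist p j) (posOf-new s m t t<)))
  where
  u : ℕ
  u = vid s (suc m) (suc t)

hexagon-row : ∀ p → p < 6 → hexDist 0 p + ∑ 5 (λ t → hexDist (suc t) p) ≡ 9
hexagon-row p p< = ≡ᵇ-sound (allBelow-sound 6 (λ p → (hexDist 0 p + ∑ 5 (λ t → hexDist (suc t) p)) ≡ᵇ 9) refl p p<)

-- attaching H_{m+1} at c_{m+1}: distances from old vertices to the new ones go through c_{m+1}
-- (9 per old vertex, beyond its distance to c_{m+1}) and the new vertices among themselves add 18
partialWiener-step : ∀ s m → partialWiener s (suc (suc m)) ≡
                     partialWiener s (suc m) + 5 * transmission s (suc m) + (5 * suc m + 1) * 9 + 18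
partialWiener-step s m = begin
    partialWiener s (suc (suc m))
  ≡⟨ cong (λ n → ∑ n F) (five-more m) ⟩
    ∑ (X + 5) F
  ≡⟨ ∑-split X 5 F ⟩
    partialWiener s (suc m) + ∑ 5 (λ t → F (X + t))
  ≡⟨ cong (partialWiener s (suc m) +_) (∑-cong 5 new-column) ⟩
    partialWiener s (suc m) + ∑ 5 (λ t → τ + X * hexDist 0 (suc t) + ∑ t (λ t′ → hexDist (suc t′) (suc t)))
  ≡⟨ cong (partialWiener s (suc m) +_) (hexagon-sums τ X) ⟩
    partialWiener s (suc m) + (5 * τ + X * 9 + 18)
  ≡⟨ regroup (partialWiener s (suc m)) (5 * τ) (X * 9) ⟩
    partialWiener s (suc m) + 5 * τ + X * 9 + 18
  ∎
  where
  open ≡-Reasoning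
  X : ℕ
  X = 5 * suc m + 1
  τ : ℕ
  τ = transmission s (suc m)
  F : ℕ → ℕ
  F v = ∑ v (λ u → chainDist s u v)
  five-more : ∀ m → 5 * suc (suc m) + 1 ≡ 5 * suc m + 1 + 5
  five-more = solve-∀
  regroup : ∀ a b c → a + (b + c + 18) ≡ a + b + c + 18
  regroup = solve-∀
  -- the five new positions: distances 1,2,3,2,1 from c_{m+1}, and 18 among themselves
  hexagon-sums : ∀ τ X → ∑ 5 (λ t → τ + X * hexDist 0 (suc t) + ∑ t (λ t′ → hexDist (suc t′) (suc t))) ≡ 5 * τ + X * 9 + 18
  hexagon-sums = expanded
    where
    expanded : ∀ τ X → (τ + X * 1 + 0) + ((τ + X * 2 + 1) + ((τ + X * 3 + 3) + ((τ + X * 2 + 6) + ((τ + X * 1 + 8) + 0))))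
                       ≡ 5 * τ + X * 9 + 18
    expanded = solve-∀
  new-column : ∀ t → t < 5 → F (X + t) ≡ τ + X * hexDist 0 (suc t) + ∑ t (λ t′ → hexDist (suc t′) (suc t))
  new-column t t< = begin
      F (X + t)
    ≡⟨ ∑-split X t (λ u → chainDist s u (X + t)) ⟩
      ∑ X (λ u → chainDist s u (X + t)) + ∑ t (λ t′ → chainDist s (X + t′) (X + t))
    ≡⟨ cong₂ _+_ (∑-cong X (λ u u< → trans (cong (chainDist s u) (new-vertex s m t)) (old-to-new s m u (suc t) u< (s≤s t<))))
                 (∑-cong t (λ t′ t′< → trans (cong₂ (chainDist s) (new-vertex s m t′) (new-vertex s m t))
                                               (within-new s m t′ (suc t) (<-trans t′< t<) (s≤s t<)))) ⟩
      ∑ X (λ u → chainDist s u (vid s (suc m) 0) + hexDist 0 (suc t)) + ∑ t (λ t′ → hexDist (suc t′) (suc t))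
    ≡⟨ cong (_+ ∑ t (λ t′ → hexDist (suc t′) (suc t)))
            (trans (∑-+ X (λ u → chainDist s u (vid s (suc m) 0)) (λ _ → hexDist 0 (suc t))) (cong (τ +_) (∑-const X (hexDist 0 (suc t))))) ⟩
      τ + X * hexDist 0 (suc t) + ∑ t (λ t′ → hexDist (suc t′) (suc t))
    ∎

-- moving the transmission from c_{m+1} to c_{m+2} = position p of H_{m+1}: every old vertex
-- gets farther by d(c_{m+1}, c_{m+2}), and the five new vertices contribute 9 - d(c_{m+1}, c_{m+2})
transmission-step : ∀ s m → transmission s (suc (suc m)) ≡ transmission s (suc m) + 5 * suc m * hexDist 0 (nextCut s (suc m)) + 9
transmission-step s m = begin
    transmission s (suc (suc m))
  ≡⟨ cong (λ n → ∑ n (λ u → chainDist s u c′)) (five-more m) ⟩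
    ∑ (X + 5) (λ u → chainDist s u c′)
  ≡⟨ ∑-split X 5 (λ u → chainDist s u c′) ⟩
    ∑ X (λ u → chainDist s u c′) + ∑ 5 (λ t → chainDist s (X + t) c′)
  ≡⟨ cong₂ _+_ (∑-cong X (λ u u< → old-to-new s m u p u< p<6))
               (∑-cong 5 (λ t t< → trans (cong (λ z → chainDist s z c′) (new-vertex s m t)) (within-new s m t p t< p<6))) ⟩
    ∑ X (λ u → chainDist s u (vid s (suc m) 0) + q) + ∑ 5 (λ t → hexDist (suc t) p)
  ≡⟨ cong (_+ ∑ 5 (λ t → hexDist (suc t) p)) (trans (∑-+ X (λ u → chainDist s u (vid s (suc m) 0)) (λ _ → q)) (cong (τ +_) (∑-const X q))) ⟩
    τ + X * q + ∑ 5 (λ t → hexDist (suc t) p)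
  ≡⟨ regroup τ m q _ ⟩
    τ + 5 * suc m * q + (q + ∑ 5 (λ t → hexDist (suc t) p))
  ≡⟨ cong (τ + 5 * suc m * q +_) (hexagon-row p p<6) ⟩
    τ + 5 * suc m * q + 9
  ∎
  where
  open ≡-Reasoning
  X : ℕ
  X = 5 * suc m + 1
  τ : ℕ
  τ = transmission s (suc m)
  p : ℕ
  p = nextCut s (suc m)
  p<6 : p < 6
  p<6 = nextCut<6 s (suc m)
  q : ℕ
  q = hexDist 0 p
  c′ : ℕ
  c′ = vid s (suc m) p
  five-more : ∀ m → 5 * suc (suc m) + 1 ≡ 5 * suc m + 1 + 5
  five-more = solve-∀
  regroup : ∀ τ m q r → τ + (5 * suc m + 1) * q + r ≡ τ + 5 * suc m * q + (q + r)
  regroup = solve-∀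

-- The Wiener index in terms of the defects of the cut vertices

-- the defect of a cut-vertex type: how much shorter than a para step (length 3) it is
defect : Pos → ℕ
defect ortho = 2
defect meta  = 1
defect para  = 0

cutDefect : List Pos → ℕ → ℕ
cutDefect s k = 3 ∸ hexDist 0 (nextCut s k)

step+defect : ∀ s k → hexDist 0 (nextCut s k) + cutDefect s k ≡ 3
step+defect s k = m+[n∸m]≡n (hexDist≤3 0 (nextCut s k))

defectSum₁ : List Pos → ℕ → ℕ
defectSum₁ s m = ∑ m (λ t → suc t * cutDefect s (suc t))

defectSum₂ : List Pos → ℕ → ℕ
defectSum₂ s m = ∑ m (λ t → suc t * (m ∸ suc t) * cutDefect s (suc t))

defectSum₂-step : ∀ s m → defectSum₂ s (suc m) ≡ defectSum₂ s m + defectSum₁ s m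
defectSum₂-step s m = begin
    ∑ (suc m) (λ t → suc t * (suc m ∸ suc t) * δ t)
  ≡⟨ ∑-last m (λ t → suc t * (m ∸ t) * δ t) ⟩
    ∑ m (λ t → suc t * (m ∸ t) * δ t) + suc m * (m ∸ m) * δ m
  ≡⟨ cong (λ x → ∑ m (λ t → suc t * (m ∸ t) * δ t) + suc m * x * δ m) (n∸n≡0 m) ⟩
    ∑ m (λ t → suc t * (m ∸ t) * δ t) + suc m * 0 * δ m
  ≡⟨ cong (λ x → ∑ m (λ t → suc t * (m ∸ t) * δ t) + x * δ m) (*-zeroʳ (suc m)) ⟩
    ∑ m (λ t → suc t * (m ∸ t) * δ t) + 0
  ≡⟨ +-identityʳ _ ⟩
    ∑ m (λ t → suc t * (m ∸ t) * δ t)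
  ≡⟨ ∑-cong m (λ t t< → trans (cong (λ x → suc t * x * δ t) (+-∸-assoc 1 t<)) (split (suc t) (m ∸ suc t) (δ t))) ⟩
    ∑ m (λ t → suc t * (m ∸ suc t) * δ t + suc t * δ t)
  ≡⟨ ∑-+ m _ _ ⟩
    defectSum₂ s m + defectSum₁ s m
  ∎
  where
  open ≡-Reasoning
  δ : ℕ → ℕ
  δ t = cutDefect s (suc t)
  split : ∀ a b c → a * suc b * c ≡ a * b * c + a * c
  split = solve-∀

-- the reference values: the para-chain, where every defect vanishes
paraTransmission : ℕ → ℕ
paraTransmission zero    = 9
paraTransmission (suc m) = paraTransmission m + 15 * suc m + 9

paraWiener : ℕ → ℕ
paraWiener zero    = 27
paraWiener (suc m) = paraWiener m + 5 * paraTransmission m + (5 * suc m + 1) * 9 + 18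

-- summing the recurrences: the defects are exactly the deviations from the para-chain
transmission-defect : ∀ s m → transmission s (suc m) + 5 * defectSum₁ s m ≡ paraTransmission m
transmission-defect s zero    = trans (+-identityʳ _) (transmission-1 s)
transmission-defect s (suc m) = begin
    transmission s (suc (suc m)) + 5 * defectSum₁ s (suc m)
  ≡⟨ cong₂ _+_ (transmission-step s m) (cong (5 *_) (∑-last m (λ t → suc t * cutDefect s (suc t)))) ⟩
    transmission s (suc m) + 5 * suc m * q + 9 + 5 * (defectSum₁ s m + suc m * δ)
  ≡⟨ regroup (transmission s (suc m)) (defectSum₁ s m) (suc m) q δ ⟩
    transmission s (suc m) + 5 * defectSum₁ s m + 5 * suc m * (q + δ) + 9
  ≡⟨ cong₂ (λ a b → a + 5 * suc m * b + 9) (transmission-defect s m) (step+defect s (suc m)) ⟩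
    paraTransmission m + 5 * suc m * 3 + 9
  ≡⟨ cong (λ z → paraTransmission m + z + 9) (fifteen m) ⟩
    paraTransmission (suc m)
  ∎
  where
  open ≡-Reasoning
  q : ℕ
  q = hexDist 0 (nextCut s (suc m))
  δ : ℕ
  δ = cutDefect s (suc m)
  regroup : ∀ T F k q d → T + 5 * k * q + 9 + 5 * (F + k * d) ≡ T + 5 * F + 5 * k * (q + d) + 9
  regroup = solve-∀
  fifteen : ∀ m → 5 * suc m * 3 ≡ 15 * suc m
  fifteen = solve-∀

partialWiener-defect : ∀ s m → partialWiener s (suc m) + 25 * defectSum₂ s m ≡ paraWiener m
partialWiener-defect s zero    = trans (+-identityʳ _) (partialWiener-1 s)
partialWiener-defect s (suc m) = begin
    partialWiener s (suc (suc m)) + 25 * defectSum₂ s (suc m)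
  ≡⟨ cong₂ (λ a b → a + 25 * b) (partialWiener-step s m) (defectSum₂-step s m) ⟩
    partialWiener s (suc m) + 5 * transmission s (suc m) + X + 18 + 25 * (defectSum₂ s m + defectSum₁ s m)
  ≡⟨ regroup (partialWiener s (suc m)) (transmission s (suc m)) (defectSum₂ s m) (defectSum₁ s m) X ⟩
    (partialWiener s (suc m) + 25 * defectSum₂ s m) + 5 * (transmission s (suc m) + 5 * defectSum₁ s m) + X + 18
  ≡⟨ cong₂ (λ a b → a + 5 * b + X + 18) (partialWiener-defect s m) (transmission-defect s m) ⟩
    paraWiener (suc m)
  ∎
  where
  open ≡-Reasoning
  X : ℕ
  X = (5 * suc m + 1) * 9
  regroup : ∀ W T E F c → W + 5 * T + c + 18 + 25 * (E + F) ≡ (W + 25 * E) + 5 * (T + 5 * F) + c + 18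
  regroup = solve-∀

weighted : (ℕ → ℕ) → List Pos → ℕ
weighted w []       = 0
weighted w (x ∷ xs) = w 0 * defect x + weighted (w ∘ suc) xs

Δ : List Pos → ℕ
Δ s = weighted (λ t → suc t * (length s ∸ t)) s

∑-weighted : ∀ (w : ℕ → ℕ) s → ∑ (length s) (λ t → w t * cutDefect s (suc t)) ≡ weighted w s
∑-weighted w []       = refl
∑-weighted w (x ∷ xs) = cong₂ _+_ (cong (w 0 *_) (head-defect x)) (∑-weighted (w ∘ suc) xs)
  where
  head-defect : ∀ x → cutDefect (x ∷ xs) 1 ≡ defect x
  head-defect ortho = refl
  head-defect meta  = refl
  head-defect para  = refl

-- the last hexagon contributes no weight, so the final second sum is Δ
defectSum₂-Δ : ∀ s → defectSum₂ s (suc (length s)) ≡ Δ s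
defectSum₂-Δ s = begin
    ∑ (suc L) f
  ≡⟨ ∑-last L f ⟩
    ∑ L f + suc L * (L ∸ L) * cutDefect s (suc L)
  ≡⟨ cong (λ x → ∑ L f + suc L * x * cutDefect s (suc L)) (n∸n≡0 L) ⟩
    ∑ L f + suc L * 0 * cutDefect s (suc L)
  ≡⟨ cong (λ x → ∑ L f + x * cutDefect s (suc L)) (*-zeroʳ (suc L)) ⟩
    ∑ L f + 0
  ≡⟨ +-identityʳ _ ⟩
    ∑ L f
  ≡⟨ ∑-weighted (λ t → suc t * (L ∸ t)) s ⟩
    Δ s
  ∎
  where
  open ≡-Reasoning
  L : ℕ
  L = length s
  f : ℕ → ℕ
  f t = suc t * (suc L ∸ suc t) * cutDefect s (suc t)

wiener-Δ : ∀ s → wiener (chain s) + 25 * Δ s ≡ paraWiener (suc (length s))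
wiener-Δ s = begin
    wiener (chain s) + 25 * Δ s
  ≡⟨ cong₂ (λ a b → a + 25 * b) (trans (wiener-partial s) (cong (partialWiener s) (+-comm (length s) 2))) (sym (defectSum₂-Δ s)) ⟩
    partialWiener s (suc (suc (length s))) + 25 * defectSum₂ s (suc (length s))
  ≡⟨ partialWiener-defect s (suc (length s)) ⟩
    paraWiener (suc (length s))
  ∎
  where open ≡-Reasoning

-- A chain is isomorphic to the chain of the reversed sequence

nextCut-beyond : ∀ s i → length s ≤ i → nextCut s (suc i) ≡ 0
nextCut-beyond []       i       _         = refl
nextCut-beyond (x ∷ xs) (suc i) (s≤s le) = nextCut-beyond xs i le

nextCut-++ˡ : ∀ ys zs i → i < length ys → nextCut (ys ++ zs) (suc i) ≡ nextCut ys (suc i)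
nextCut-++ˡ (y ∷ ys) zs zero    _        = refl
nextCut-++ˡ (y ∷ ys) zs (suc i) (s≤s lt) = nextCut-++ˡ ys zs i lt

nextCut-++ʳ : ∀ ys zs i → nextCut (ys ++ zs) (suc (length ys + i)) ≡ nextCut zs (suc i)
nextCut-++ʳ []       zs i = refl
nextCut-++ʳ (y ∷ ys) zs i = nextCut-++ʳ ys zs i

nextCut-reverse : ∀ s i → i < length s → nextCut (reverse s) (suc i) ≡ nextCut s (suc (length s ∸ suc i))
nextCut-reverse (x ∷ xs) i i< with <-cmp i (length xs)
... | tri< i<len _ _ = begin
    nextCut (reverse (x ∷ xs)) (suc i)
  ≡⟨ cong (λ l → nextCut l (suc i)) (unfold-reverse x xs) ⟩
    nextCut (reverse xs ++ x ∷ []) (suc i)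
  ≡⟨ nextCut-++ˡ (reverse xs) (x ∷ []) i (subst (i <_) (sym (length-reverse xs)) i<len) ⟩
    nextCut (reverse xs) (suc i)
  ≡⟨ nextCut-reverse xs i i<len ⟩
    nextCut xs (suc (length xs ∸ suc i))
  ≡⟨ cong (λ j → nextCut (x ∷ xs) (suc j)) (sym (+-∸-assoc 1 i<len)) ⟩
    nextCut (x ∷ xs) (suc (length xs ∸ i))
  ∎
  where open ≡-Reasoning
... | tri≈ _ refl _ = begin
    nextCut (reverse (x ∷ xs)) (suc (length xs))
  ≡⟨ cong (λ l → nextCut l (suc (length xs))) (unfold-reverse x xs) ⟩
    nextCut (reverse xs ++ x ∷ []) (suc (length xs))
  ≡⟨ cong (λ j → nextCut (reverse xs ++ x ∷ []) (suc j)) (sym (trans (+-identityʳ _) (length-reverse xs))) ⟩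
    nextCut (reverse xs ++ x ∷ []) (suc (length (reverse xs) + 0))
  ≡⟨ nextCut-++ʳ (reverse xs) (x ∷ []) 0 ⟩
    posNum x
  ≡⟨ cong (λ j → nextCut (x ∷ xs) (suc j)) (sym (n∸n≡0 (length xs))) ⟩
    nextCut (x ∷ xs) (suc (length xs ∸ length xs))
  ∎
  where open ≡-Reasoning
... | tri> _ _ len<i = ⊥-elim (<⇒≱ len<i (≤-pred i<))

-- t reverses s: H_k of s corresponds to H_{L+1-k} of t, its cut vertex c_{k+1} to c_{L+1-k};
-- so the position of the outgoing cut vertex of H_{L+1-k} in t is that of H_k in s
Reverses : List Pos → List Pos → Set
Reverses s t = (length t ≡ length s) × (∀ k → k < hexCount s → nextCut t (suc (length s) ∸ k) ≡ nextCut s k)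

reverse-Reverses : ∀ s → Reverses s (reverse s)
reverse-Reverses s = length-reverse s , matching
  where
  L : ℕ
  L = length s
  matching : ∀ k → k < hexCount s → nextCut (reverse s) (suc L ∸ k) ≡ nextCut s k
  matching zero    _  = nextCut-beyond (reverse s) L (≤-reflexive (length-reverse s))
  matching (suc i) k< with <-cmp i L
  ... | tri< i<L _ _ = begin
      nextCut (reverse s) (L ∸ i)
    ≡⟨ cong (nextCut (reverse s)) (+-∸-assoc 1 i<L) ⟩
      nextCut (reverse s) (suc (L ∸ suc i))
    ≡⟨ nextCut-reverse s (L ∸ suc i) (≤-trans (≤-reflexive (sym (+-∸-assoc 1 i<L))) (m∸n≤m L i)) ⟩
      nextCut s (suc (L ∸ suc (L ∸ suc i)))
    ≡⟨ cong (λ j → nextCut s (suc j)) (trans (cong (L ∸_) (sym (+-∸-assoc 1 i<L))) (m∸[m∸n]≡n (<⇒≤ i<L))) ⟩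
      nextCut s (suc i)
    ∎
    where open ≡-Reasoning
  ... | tri≈ _ refl _ = trans (cong (nextCut (reverse s)) (n∸n≡0 L)) (sym (nextCut-beyond s L ≤-refl))
  ... | tri> _ _ L<i  = ⊥-elim (<⇒≱ L<i (≤-pred (≤-pred (≤-trans k< (≤-reflexive (+-comm L 2))))))

hexagon≤ : ∀ s k → k < hexCount s → k ≤ suc (length s)
hexagon≤ s k k< = ≤-pred (≤-trans k< (≤-reflexive (+-comm (length s) 2)))

module _ {s t : List Pos} (rev : Reverses s t) where
  private
    L : ℕ
    L = length s

  opposite<hexCount : ∀ k → suc L ∸ k < hexCount t
  opposite<hexCount k = ≤-trans (s≤s (m∸n≤m (suc L) k)) (≤-reflexive (trans (+-comm 2 L) (cong (_+ 2) (sym (proj₁ rev)))))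

  flip : ℕ → ℕ
  flip x = vid t (suc L ∸ hexOf x) (mirror (nextCut s (hexOf x)) (posOf x))

  -- on vertex names: the cut vertex c_{k+1} = position 0 of H_{k+1} = position nextCut s k of H_k
  -- goes consistently to position 0 of H_{L+1-k} in t
  flip-vid : ∀ k j → k < hexCount s → j < 6 → flip (vid s k j) ≡ vid t (suc L ∸ k) (mirror (nextCut s k) j)
  flip-vid zero    j       k< j<        = cong₂ (λ a b → vid t (suc L ∸ a) (mirror (nextCut s a) b)) (hexOf-first s j j<) (posOf-first s j j<)
  flip-vid (suc k) (suc j) k< (s≤s j<5) = cong₂ (λ a b → vid t (suc L ∸ a) (mirror (nextCut s a) b)) (hexOf-new s k j j<5) (posOf-new s k j j<5)
  flip-vid (suc k) zero    k< _         = begin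
      flip (vid s k c)
    ≡⟨ flip-vid k c (<-trans (n<1+n k) k<) (nextCut<6 s k) ⟩
      vid t (suc L ∸ k) (mirror c c)
    ≡⟨ cong (vid t (suc L ∸ k)) (mirror-self c (nextCut<6 s k)) ⟩
      vid t (suc L ∸ k) 0
    ≡⟨ cong (λ z → vid t z 0) (+-∸-assoc 1 (hexagon≤ s (suc k) k<)) ⟩
      vid t (suc (suc L ∸ suc k)) 0
    ≡⟨ cong (vid t (suc L ∸ suc k)) (trans (proj₂ rev (suc k) k<) (sym (mirror-0 (nextCut s (suc k)) (nextCut<6 s (suc k))))) ⟩
      vid t (suc L ∸ suc k) (mirror (nextCut s (suc k)) 0)
    ∎
    where
    open ≡-Reasoning
    c : ℕ
    c = nextCut s k

  flip<N : ∀ x → flip x < N (chain t)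
  flip<N x = vid<N t _ _ (opposite<hexCount (hexOf x)) (mirror<6 (nextCut s (hexOf x)) (posOf x))

  -- edges of H_k go to edges of H_{L+1-k} (with the opposite orientation)
  flip-adj : ∀ x y → adj (chain s) x y ≡ true → adj (chain t) (flip x) (flip y) ≡ true
  flip-adj x y x~y with adj-edge s x y x~y
  ... | k , j , k< , j< , inj₁ (refl , refl) =
          edge-adj t (suc L ∸ k) (mirror p (next j)) _ _ (opposite<hexCount k) (mirror<6 p (next j))
            (inj₂ (flip-vid k (next j) k< (next<6 j) , trans (flip-vid k j k< j<) (cong (vid t (suc L ∸ k)) (mirror-next p j (nextCut<6 s k) j<))))
    where
    p : ℕ
    p = nextCut s k
  ... | k , j , k< , j< , inj₂ (refl , refl) =
          edge-adj t (suc L ∸ k) (mirror p (next j)) _ _ (opposite<hexCount k) (mirror<6 p (next j))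
            (inj₁ (flip-vid k (next j) k< (next<6 j) , trans (flip-vid k j k< j<) (cong (vid t (suc L ∸ k)) (mirror-next p j (nextCut<6 s k) j<))))
    where
    p : ℕ
    p = nextCut s k

flip-involutive : ∀ {s t} (rev : Reverses s t) (rev′ : Reverses t s) → ∀ x → x < N (chain s) → flip rev′ (flip rev x) ≡ x
flip-involutive {s} {t} rev rev′ x x< = begin
    flip rev′ (vid t k′ j′)
  ≡⟨ flip-vid rev′ k′ j′ (opposite<hexCount rev k) (mirror<6 (nextCut s k) (posOf x)) ⟩
    vid s (suc (length t) ∸ k′) (mirror (nextCut t k′) j′)
  ≡⟨ cong₂ (vid s) (trans (cong (λ l → suc l ∸ k′) (proj₁ rev)) (m∸[m∸n]≡n (hexagon≤ s k k<)))
                   (cong (λ p → mirror p j′) (proj₂ rev k k<)) ⟩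
    vid s k (mirror (nextCut s k) (mirror (nextCut s k) (posOf x)))
  ≡⟨ cong (vid s k) (mirror-involutive (nextCut s k) (posOf x) (nextCut<6 s k) (posOf<6 x)) ⟩
    vid s k (posOf x)
  ≡⟨ vid-coordinates s x ⟩
    x
  ∎
  where
  open ≡-Reasoning
  k : ℕ
  k = hexOf x
  k< : k < hexCount s
  k< = hexOf<hexCount s x x<
  k′ : ℕ
  k′ = suc (length s) ∸ k
  j′ : ℕ
  j′ = mirror (nextCut s k) (posOf x)

reverses-≅ : ∀ {s t} → Reverses s t → Reverses t s → chain s ≅ chain t
reverses-≅ {s} {t} rev rev′ = mk↔ₛ′ to from to∘from from∘to , preserves
  where
  to : Fin (N (chain s)) → Fin (N (chain t))
  to i = fromℕ< (flip<N rev (toℕ i))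
  from : Fin (N (chain t)) → Fin (N (chain s))
  from i = fromℕ< (flip<N rev′ (toℕ i))
  to∘from : ∀ y → to (from y) ≡ y
  to∘from y = toℕ-injective (trans (toℕ-fromℕ< _) (trans (cong (flip rev) (toℕ-fromℕ< (flip<N rev′ (toℕ y)))) (flip-involutive rev′ rev (toℕ y) (toℕ<n y))))
  from∘to : ∀ x → from (to x) ≡ x
  from∘to x = toℕ-injective (trans (toℕ-fromℕ< _) (trans (cong (flip rev′) (toℕ-fromℕ< (flip<N rev (toℕ x)))) (flip-involutive rev rev′ (toℕ x) (toℕ<n x))))
  preserves : ∀ x y → adj (chain s) (toℕ x) (toℕ y) ≡ adj (chain t) (toℕ (to x)) (toℕ (to y))
  preserves x y = trans (bool-ext (flip-adj rev (toℕ x) (toℕ y)) backward)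
                        (sym (cong₂ (adj (chain t)) (toℕ-fromℕ< (flip<N rev (toℕ x))) (toℕ-fromℕ< (flip<N rev (toℕ y)))))
    where
    backward : adj (chain t) (flip rev (toℕ x)) (flip rev (toℕ y)) ≡ true → adj (chain s) (toℕ x) (toℕ y) ≡ true
    backward e = subst₂ (λ a b → adj (chain s) a b ≡ true)
      (flip-involutive rev rev′ (toℕ x) (toℕ<n x)) (flip-involutive rev rev′ (toℕ y) (toℕ<n y))
      (flip-adj rev′ (flip rev (toℕ x)) (flip rev (toℕ y)) e)

reverse-≅ : ∀ s → chain s ≅ chain (reverse s)
reverse-≅ s = reverses-≅ (reverse-Reverses s) (subst (Reverses (reverse s)) (reverse-involutive s) (reverse-Reverses (reverse s)))

single : ℕ → ℕ → List Pos
single t r = replicate t para ++ meta ∷ replicate r para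

length-single : ∀ t r → length (single t r) ≡ t + suc r
length-single t r = trans (length-++ (replicate t para)) (cong₂ _+_ (length-replicate t) (cong suc (length-replicate r)))

reverse-replicate : ∀ m (x : Pos) → reverse (replicate m x) ≡ replicate m x
reverse-replicate zero    x = refl
reverse-replicate (suc m) x = trans (unfold-reverse x (replicate m x)) (trans (cong (_++ x ∷ []) (reverse-replicate m x)) (snoc m))
  where
  snoc : ∀ m → replicate m x ++ x ∷ [] ≡ x ∷ replicate m x
  snoc zero    = refl
  snoc (suc m) = cong (x ∷_) (snoc m)

reverse-single : ∀ t r → reverse (single t r) ≡ single r t
reverse-single t r = begin
    reverse (replicate t para ++ meta ∷ replicate r para)
  ≡⟨ reverse-++ (replicate t para) (meta ∷ replicate r para) ⟩
    reverse (meta ∷ replicate r para) ++ reverse (replicate t para)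
  ≡⟨ cong₂ _++_ (trans (unfold-reverse meta (replicate r para)) (cong (_++ meta ∷ []) (reverse-replicate r para)))
                (reverse-replicate t para) ⟩
    (replicate r para ++ meta ∷ []) ++ replicate t para
  ≡⟨ ++-assoc (replicate r para) (meta ∷ []) (replicate t para) ⟩
    single r t
  ∎
  where open ≡-Reasoning

totalDefect : List Pos → ℕ
totalDefect []       = 0
totalDefect (x ∷ xs) = defect x + totalDefect xs

totalDefect-0 : ∀ s → totalDefect s ≡ 0 → s ≡ replicate (length s) para
totalDefect-0 []          _ = refl
totalDefect-0 (para ∷ xs) e = cong (para ∷_) (totalDefect-0 xs e)

totalDefect-1 : ∀ s → totalDefect s ≡ 1 → Σ ℕ λ t → Σ ℕ λ r → s ≡ single t r
totalDefect-1 (para ∷ xs) e with totalDefect-1 xs e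
... | t , r , refl = suc t , r , refl
totalDefect-1 (meta ∷ xs) e = 0 , length xs , cong (meta ∷_) (totalDefect-0 xs (suc-injective e))

weighted-para : ∀ (w : ℕ → ℕ) m → weighted w (replicate m para) ≡ 0
weighted-para w zero    = refl
weighted-para w (suc m) = trans (cong (_+ weighted (w ∘ suc) (replicate m para)) (*-zeroʳ (w 0))) (weighted-para (w ∘ suc) m)

weighted-single : ∀ (w : ℕ → ℕ) t r → weighted w (single t r) ≡ w t
weighted-single w zero    r = trans (cong₂ _+_ (*-identityʳ (w 0)) (weighted-para (w ∘ suc) r)) (+-identityʳ (w 0))
weighted-single w (suc t) r = trans (cong (_+ weighted (w ∘ suc) (single t r)) (*-zeroʳ (w 0))) (weighted-single (w ∘ suc) t r)

weighted-lower : ∀ (w : ℕ → ℕ) s c → (∀ t → t < length s → c ≤ w t) → c * totalDefect s ≤ weighted w s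
weighted-lower w []       c c≤w = ≤-reflexive (*-zeroʳ c)
weighted-lower w (x ∷ xs) c c≤w = ≤-trans (≤-reflexive (*-distribˡ-+ c (defect x) (totalDefect xs)))
  (+-mono-≤ (*-monoˡ-≤ (defect x) (c≤w 0 z<s)) (weighted-lower (w ∘ suc) xs c (λ t t< → c≤w (suc t) (s<s t<))))

weight≥ : ∀ L t → t < L → L ≤ suc t * (L ∸ t)
weight≥ L t t<L = ≤-trans (≤-reflexive (sym (m+[n∸m]≡n t<L)))
  (≤-trans (m≤m+n (suc t + r) (t * r)) (≤-reflexive (trans (expand t r) (cong (suc t *_) (sym (+-∸-assoc 1 t<L))))))
  where
  r : ℕ
  r = L ∸ suc t
  expand : ∀ t r → suc t + r + t * r ≡ suc t * suc r
  expand = solve-∀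

Δ-lower : ∀ s → length s * totalDefect s ≤ Δ s
Δ-lower s = weighted-lower _ s (length s) (weight≥ (length s))

Δ-para : ∀ m → Δ (replicate m para) ≡ 0
Δ-para m = weighted-para _ m

Δ-single : ∀ t r → Δ (single t r) ≡ suc t * suc r
Δ-single t r = trans (weighted-single (λ i → suc i * (length (single t r) ∸ i)) t r)
               (trans (cong (λ L → suc t * (L ∸ t)) (length-single t r)) (cong (suc t *_) (m+n∸m≡n t (suc r))))

positive-defect : ∀ s → s ≢ replicate (length s) para → Σ ℕ λ d → totalDefect s ≡ suc d
positive-defect s s≢P with totalDefect s in e
... | zero  = ⊥-elim (s≢P (totalDefect-0 s e))
... | suc d = d , refl

-- The three smallest values of Δ

single-excess : ∀ t r → suc t * suc r ≡ t + suc r + t * r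
single-excess = solve-∀

factor≤1 : ∀ l d → suc l * suc d ≤ suc l → d ≡ 0
factor≤1 l d le = m*n≡0⇒m≡0 d (suc l) (trans (*-comm d (suc l))
  (n≤0⇒n≡0 (+-cancelˡ-≤ (suc l) _ 0 (≤-trans (≤-reflexive (sym (*-suc (suc l) d))) (≤-trans le (≤-reflexive (sym (+-identityʳ (suc l)))))))))

Δ≡0 : ∀ s → Δ s ≡ 0 → s ≡ replicate (length s) para
Δ≡0 []       _   = refl
Δ≡0 (x ∷ xs) Δ≡0 = totalDefect-0 (x ∷ xs)
  (m*n≡0⇒m≡0 (totalDefect (x ∷ xs)) (length (x ∷ xs))
    (trans (*-comm (totalDefect (x ∷ xs)) (suc (length xs))) (n≤0⇒n≡0 (≤-trans (Δ-lower (x ∷ xs)) (≤-reflexive Δ≡0)))))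

second-Δ : ∀ l s → length s ≡ suc l → s ≢ replicate (suc l) para →
           Δ (single l 0) ≤ Δ s × (Δ s ≡ Δ (single l 0) → (s ≡ single l 0) ⊎ (s ≡ reverse (single l 0)))
second-Δ l s len s≢P with positive-defect s (λ e → s≢P (trans e (cong (λ m → replicate m para) len)))
... | d , td≡ = ≤-trans (≤-reflexive ΔSec) (≤-trans (m≤m*n (suc l) (suc d)) bound) , equality
  where
  ΔSec : Δ (single l 0) ≡ suc l
  ΔSec = trans (Δ-single l 0) (*-identityʳ (suc l))
  bound : suc l * suc d ≤ Δ s
  bound = subst₂ (λ a b → a * b ≤ Δ s) len td≡ (Δ-lower s)
  equality : Δ s ≡ Δ (single l 0) → (s ≡ single l 0) ⊎ (s ≡ reverse (single l 0))
  equality e with factor≤1 l d (≤-trans bound (≤-reflexive (trans e ΔSec)))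
  ... | refl with totalDefect-1 s td≡
  ...   | t , r , refl with m*n≡0⇒m≡0∨n≡0 t {r} (+-cancelˡ-≡ (t + suc r) (t * r) 0 excess)
    where
    excess : t + suc r + t * r ≡ t + suc r + 0
    excess = trans (sym (single-excess t r)) (trans (sym (Δ-single t r)) (trans e (trans ΔSec (sym (trans (+-identityʳ _) (trans (sym (length-single t r)) len))))))
  ...     | inj₂ refl = inj₁ (cong (λ t → single t 0) (suc-injective (trans (sym (+-comm t 1)) (trans (sym (length-single t 0)) len))))
  ...     | inj₁ refl = inj₂ (trans (cong (single 0) (suc-injective (trans (sym (length-single 0 r)) len))) (sym (reverse-single l 0)))

inner-excess : ∀ t r → suc (suc t) * suc (suc r) ≡ suc (suc (t + r)) * 2 + t * r
inner-excess = solve-∀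

third-Δ : ∀ j s → length s ≡ 3 + j → s ≢ replicate (3 + j) para → s ≢ single (2 + j) 0 → s ≢ single 0 (2 + j) →
          Δ (single (suc j) 1) ≤ Δ s × (Δ s ≡ Δ (single (suc j) 1) → (s ≡ single (suc j) 1) ⊎ (s ≡ reverse (single (suc j) 1)))
third-Δ j s len s≢P s≢Sec s≢Sec′ with positive-defect s (λ e → s≢P (trans e (cong (λ m → replicate m para) len)))
... | suc d , td≡ = <⇒≤ more , λ e → ⊥-elim (<⇒≢ more (sym e))
  where
  -- two or more defects already give at least 2L > 2(L-1)
  more : Δ (single (suc j) 1) < Δ s
  more = ≤-trans (≤-reflexive (cong suc (Δ-single (suc j) 1)))
           (≤-trans (≤-trans (n≤1+n _) (≤-reflexive (twice j))) (≤-trans (*-monoʳ-≤ (3 + j) (s≤s (s≤s z≤n)))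
             (subst₂ (λ a b → a * b ≤ Δ s) len td≡ (Δ-lower s))))
    where
    twice : ∀ j → suc (suc (suc (suc j) * 2)) ≡ (3 + j) * 2
    twice = solve-∀
... | zero , td≡ with totalDefect-1 s td≡
...   | zero , r , refl = ⊥-elim (s≢Sec′ (cong (single 0) (suc-injective (trans (sym (length-single 0 r)) len))))
...   | suc t , zero , refl = ⊥-elim (s≢Sec (cong (λ t → single t 0) (suc-injective (trans (sym (+-comm (suc t) 1)) (trans (sym (length-single (suc t) 0)) len)))))
...   | suc t , suc r , refl = ≤-trans (≤-reflexive ΔThr) (≤-trans (m≤m+n _ (t * r)) (≤-reflexive (sym Δs))) , equality
  where
  t+r≡j : t + r ≡ j
  t+r≡j = suc-injective (suc-injective (suc-injective (trans (shift t r) (trans (sym (length-single (suc t) (suc r))) len))))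
    where
    shift : ∀ t r → 3 + (t + r) ≡ suc t + suc (suc r)
    shift = solve-∀
  ΔThr : Δ (single (suc j) 1) ≡ suc (suc j) * 2
  ΔThr = Δ-single (suc j) 1
  Δs : Δ (single (suc t) (suc r)) ≡ suc (suc j) * 2 + t * r
  Δs = trans (Δ-single (suc t) (suc r)) (trans (inner-excess t r) (cong (λ x → suc (suc x) * 2 + t * r) t+r≡j))
  equality : Δ (single (suc t) (suc r)) ≡ Δ (single (suc j) 1) →
             (single (suc t) (suc r) ≡ single (suc j) 1) ⊎ (single (suc t) (suc r) ≡ reverse (single (suc j) 1))
  equality e with m*n≡0⇒m≡0∨n≡0 t {r} (+-cancelˡ-≡ (suc (suc j) * 2) (t * r) 0 (trans (sym Δs) (trans e (trans ΔThr (sym (+-identityʳ _))))))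
  ... | inj₂ refl = inj₁ (cong (λ t → single (suc t) 1) (trans (sym (+-identityʳ t)) t+r≡j))
  ... | inj₁ refl = inj₂ (trans (cong (λ r → single 1 (suc r)) t+r≡j) (sym (reverse-single (suc j) 1)))

≅-refl : ∀ G → G ≅ G
≅-refl G = mk↔ₛ′ id id (λ _ → refl) (λ _ → refl) , λ _ _ → refl

reversal-≅ : ∀ c → chain (reverse c) ≅ chain c
reversal-≅ c = subst (λ t → chain (reverse c) ≅ chain t) (reverse-involutive c) (reverse-≅ (reverse c))

module _ (s t : List Pos) (len : length s ≡ length t) where
  private
    balance : wiener (chain s) + 25 * Δ s ≡ wiener (chain t) + 25 * Δ t
    balance = trans (wiener-Δ s) (trans (cong (λ L → paraWiener (suc L)) len) (sym (wiener-Δ t)))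

  wiener-≤ : Δ t ≤ Δ s → wiener (chain s) ≤ wiener (chain t)
  wiener-≤ Δt≤Δs = +-cancelʳ-≤ (25 * Δ t) _ _ (≤-trans (+-monoʳ-≤ (wiener (chain s)) (*-monoʳ-≤ 25 Δt≤Δs)) (≤-reflexive balance))

  wiener-≡⇒Δ-≡ : wiener (chain s) ≡ wiener (chain t) → Δ s ≡ Δ t
  wiener-≡⇒Δ-≡ W≡ = *-cancelˡ-≡ (Δ s) (Δ t) 25 (+-cancelˡ-≡ (wiener (chain s)) _ _ (trans balance (cong (_+ 25 * Δ t) (sym W≡))))

  Δ-≢⇒≇ : Δ s ≢ Δ t → ¬ (chain s ≅ chain t)
  Δ-≢⇒≇ Δ≢ iso = Δ≢ (wiener-≡⇒Δ-≡ (wiener-≅ iso (symmetricDist-chain s) (symmetricDist-chain t)))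

Dominates : List Pos → List Pos → Set
Dominates c s = (wiener (chain s) ≤ wiener (chain c)) × (wiener (chain s) ≡ wiener (chain c) → chain s ≅ chain c)

extremal : ∀ c s → length s ≡ length c → Δ c ≤ Δ s × (Δ s ≡ Δ c → (s ≡ c) ⊎ (s ≡ reverse c)) → Dominates c s
extremal c s len (least , only) = wiener-≤ s c len least , λ W≡ → unique (only (wiener-≡⇒Δ-≡ s c len W≡))
  where
  unique : (s ≡ c) ⊎ (s ≡ reverse c) → chain s ≅ chain c
  unique (inj₁ refl) = ≅-refl (chain c)
  unique (inj₂ refl) = reversal-≅ c

≇⇒≢ : ∀ {s c} → ¬ (chain s ≅ chain c) → s ≢ c
≇⇒≢ {c = c} s≇c refl = s≇c (≅-refl (chain c))

≇⇒≢reverse : ∀ {s c} → ¬ (chain s ≅ chain c) → s ≢ reverse c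
≇⇒≢reverse {c = c} s≇c refl = s≇c (reversal-≅ c)

length-next : ∀ j → length (single (suc j) 1) ≡ 3 + j
length-next j = trans (length-single (suc j) 1) (+-comm (suc j) 2)

para-maximal : ∀ L s → length s ≡ L → Dominates (replicate L para) s
para-maximal L s len = extremal (replicate L para) s (trans len (sym (length-replicate L)))
  (subst (_≤ Δ s) (sym (Δ-para L)) z≤n , λ Δ≡ → inj₁ (trans (Δ≡0 s (trans Δ≡ (Δ-para L))) (cong (λ m → replicate m para) len)))

end≇para : ∀ l → ¬ (chain (single l 0) ≅ chain (replicate (suc l) para))
end≇para l = Δ-≢⇒≇ (single l 0) (replicate (suc l) para)
  (trans (length-single l 0) (trans (+-comm l 1) (sym (length-replicate (suc l)))))
  (λ Δ≡ → 0≢1+n (sym (trans (sym (trans (Δ-single l 0) (*-identityʳ (suc l)))) (trans Δ≡ (Δ-para (suc l))))))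

end-second : ∀ l s → length s ≡ suc l → ¬ (chain s ≅ chain (replicate (suc l) para)) → Dominates (single l 0) s
end-second l s len s≇P = extremal (single l 0) s (trans len (sym (trans (length-single l 0) (+-comm l 1))))
  (second-Δ l s len (≇⇒≢ s≇P))

-- the meta step next to an end needs L ≥ 3, i.e. k ≥ 1 para steps before it
next≇para : ∀ k → 1 ≤ k → ¬ (chain (single k 1) ≅ chain (replicate (2 + k) para))
next≇para (suc j) _ = Δ-≢⇒≇ (single (suc j) 1) (replicate (3 + j) para) (trans (length-next j) (sym (length-replicate (3 + j))))
  (λ Δ≡ → 0≢1+n (sym (trans (sym (Δ-single (suc j) 1)) (trans Δ≡ (Δ-para (3 + j))))))

next≇end : ∀ k → 1 ≤ k → ¬ (chain (single k 1) ≅ chain (single (suc k) 0))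
next≇end (suc j) _ = Δ-≢⇒≇ (single (suc j) 1) (single (2 + j) 0)
  (trans (length-next j) (sym (trans (length-single (2 + j) 0) (+-comm (2 + j) 1))))
  (λ Δ≡ → 0≢1+n (sym (+-cancelˡ-≡ ((3 + j) * 1) (suc j) 0
    (trans (sym (excess j)) (trans (sym (Δ-single (suc j) 1)) (trans Δ≡ (trans (Δ-single (2 + j) 0) (sym (+-identityʳ _)))))))))
  where
  excess : ∀ j → suc (suc j) * 2 ≡ (3 + j) * 1 + suc j
  excess = solve-∀

next-third : ∀ k → 1 ≤ k → ∀ s → length s ≡ 2 + k → ¬ (chain s ≅ chain (replicate (2 + k) para)) →
             ¬ (chain s ≅ chain (single (suc k) 0)) → Dominates (single k 1) s
next-third (suc j) _ s len s≇P s≇Sec = extremal (single (suc j) 1) s (trans len (sym (length-next j)))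
  (third-Δ j s len (≇⇒≢ s≇P) (≇⇒≢ s≇Sec) (λ e → ≇⇒≢reverse {c = single (2 + j) 0} s≇Sec (trans e (sym (reverse-single (2 + j) 0)))))

theorem2p5 : (n : ℕ) → 4 ≤ n →
  -- (i) P_n is the unique chain with maximum Wiener index
  ((s : List Pos) → length s ≡ n ∸ 2 →
     (wiener (chain s) ≤ wiener (chain (replicate (n ∸ 2) para)))
     × (wiener (chain s) ≡ wiener (chain (replicate (n ∸ 2) para)) →
        chain s ≅ chain (replicate (n ∸ 2) para)))
  -- (ii) (p,…,p,m) is the unique chain with second maximal Wiener index
  × (¬ (chain (replicate (n ∸ 3) para ++ meta ∷ [])
          ≅ chain (replicate (n ∸ 2) para)))
  × ((s : List Pos) → length s ≡ n ∸ 2 →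
     ¬ (chain s ≅ chain (replicate (n ∸ 2) para)) →
     (wiener (chain s) ≤ wiener (chain (replicate (n ∸ 3) para ++ meta ∷ [])))
     × (wiener (chain s) ≡ wiener (chain (replicate (n ∸ 3) para ++ meta ∷ [])) →
        chain s ≅ chain (replicate (n ∸ 3) para ++ meta ∷ [])))
  -- (iii) (p,…,p,m,p) is the unique chain with third maximal Wiener index
  -- (only meaningful for n ≥ 5: for n = 4 it is the reversal of (ii))
  × (5 ≤ n → ¬ (chain (replicate (n ∸ 4) para ++ meta ∷ para ∷ [])
          ≅ chain (replicate (n ∸ 2) para)))
  × (5 ≤ n → ¬ (chain (replicate (n ∸ 4) para ++ meta ∷ para ∷ [])
          ≅ chain (replicate (n ∸ 3) para ++ meta ∷ [])))
  × (5 ≤ n → (s : List Pos) → length s ≡ n ∸ 2 →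
     ¬ (chain s ≅ chain (replicate (n ∸ 2) para)) →
     ¬ (chain s ≅ chain (replicate (n ∸ 3) para ++ meta ∷ [])) →
     (wiener (chain s) ≤ wiener (chain (replicate (n ∸ 4) para ++ meta ∷ para ∷ [])))
     × (wiener (chain s) ≡ wiener (chain (replicate (n ∸ 4) para ++ meta ∷ para ∷ [])) →
        chain s ≅ chain (replicate (n ∸ 4) para ++ meta ∷ para ∷ [])))
theorem2p5 (suc (suc (suc (suc k)))) (s≤s (s≤s (s≤s (s≤s _)))) =
  para-maximal (2 + k) , end≇para (suc k) , end-second (suc k) ,
  (λ 5≤n → next≇para k (1≤k 5≤n)) , (λ 5≤n → next≇end k (1≤k 5≤n)) , (λ 5≤n → next-third k (1≤k 5≤n))
  where
  1≤k : 5 ≤ 4 + k → 1 ≤ k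
  1≤k = +-cancelˡ-≤ 4 1 k
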